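{- Let $n \geq 3$ be an integer, let $R_n$ denote the square rook's graph and $R_n^c$ its complement. Then the critical groups and Smith groups of these graphs are given by the following isomorphisms: \begin{align*} K(R_{n}) &\cong \left(\mathbb{Z}/2n\mathbb{Z}\right)^{(n-2)^2 + 1} \oplus \left(\mathbb{Z}/2n^{2}\mathbb{Z}\right)^{2(n-2)},\\ S(R_{n}) &\cong \left(\mathbb{Z}/2\mathbb{Z}\right)^{(n-2)^{2}} \oplus \left(\mathbb{Z}/2(n-2)\mathbb{Z}\right)^{2n-3} \oplus \mathbb{Z}/2(n-1)(n-2)\mathbb{Z},\\ K(R_{n}^{c}) &\cong \left(\mathbb{Z}/n(n-2)\mathbb{Z}\right)^{(n-2)^{2}-1} \oplus \left(\mathbb{Z}/n(n-1)(n-2)\mathbb{Z}\right)^{2} \oplus \left(\mathbb{Z}/n^{2}(n-1)(n-2)\mathbb{Z}\right)^{2(n-2)},\\ S(R_{n}^{c}) &\cong \left(\mathbb{Z}/(n-1)\mathbb{Z}\right)^{2(n-1)} \oplus \mathbb{Z}/(n-1)^{2}\mathbb{Z}. \end{align*}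
   Context: The square rook's graph $R_n$ has as vertex set the $n^2$ squares of an $n\times n$ grid, two distinct squares being adjacent when they lie in the same row or the same column (equivalently, $R_n$ is the Cartesian product $K_n \square K_n$, or the line graph of $K_{n,n}$). Its complement $R_n^c$ has the same vertex set, with two distinct squares adjacent iff they lie in different rows and different columns. For a simple graph $\Gamma$ with vertices ordered arbitrarily, the adjacency matrix $A$ has $(i,j)$ entry $1$ if vertices $i,j$ are adjacent and $0$ otherwise; the Laplacian matrix is $L = D - A$ where $D$ is the diagonal matrix of vertex degrees. Viewing an integer square matrix $M$ indexed by the vertices as a homomorphism $\mathbb{Z}^{V} \to \mathbb{Z}^{V}$, the Smith group $S(\Gamma)$ is the cokernel $\mathbb{Z}^V/\operatorname{im}(A)$, and the critical group $K(\Gamma)$ is the torsion subgroup of the cokernel $\mathbb{Z}^V/\operatorname{im}(L)$. -}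

module Defs where

open import Data.Nat as ℕ using (ℕ; zero; suc)
open import Data.Integer using (ℤ; +_; _-_; _*_; _+_; 0ℤ; 1ℤ)
open import Data.Integer.Divisibility using (_∣_)
open import Data.Fin using (Fin; zero; suc)
open import Data.Fin.Properties using (_≟_)
open import Data.Bool using (Bool; true; false; if_then_else_; _∧_; _xor_; not)
open import Data.List using (List; length; lookup)
open import Data.Product using (Σ; _×_; _,_)
open import Data.Unit using (⊤)
open import Relation.Nullary.Decidable using (⌊_⌋)
open import Relation.Binary.PropositionalEquality using (_≡_)

-- Vertices of R_n / R_n^c : the squares (row , column) of an n × n grid.
Vertex : ℕ → Set
Vertex n = Fin n × Fin n

Mat : ℕ → Set
Mat n = Vertex n → Vertex n → ℤ

Vec : ℕ → Set
Vec n = Vertex n → ℤ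

sumFin : ∀ {m} → (Fin m → ℤ) → ℤ
sumFin {zero}  f = 0ℤ
sumFin {suc m} f = f zero + sumFin (λ i → f (suc i))

sumV : ∀ {n} → (Vertex n → ℤ) → ℤ
sumV f = sumFin (λ k → sumFin (λ l → f (k , l)))

apply : ∀ {n} → Mat n → Vec n → Vec n
apply M x v = sumV (λ w → M v w * x w)

_+ᵥ_ : ∀ {n} → Vec n → Vec n → Vec n
(x +ᵥ y) v = x v + y v

_-ᵥ_ : ∀ {n} → Vec n → Vec n → Vec n
(x -ᵥ y) v = x v - y v

scale : ∀ {n} → ℤ → Vec n → Vec n
scale k x v = k * x v

b2z : Bool → ℤ
b2z true  = 1ℤ
b2z false = 0ℤ

sameRow sameCol eqV : ∀ {n} → Vertex n → Vertex n → Bool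
sameRow (i , j) (k , l) = ⌊ i ≟ k ⌋
sameCol (i , j) (k , l) = ⌊ j ≟ l ⌋
eqV v w = sameRow v w ∧ sameCol v w

-- Adjacency matrix of the rook's graph R_n: distinct squares in the same row
-- or the same column (i.e. exactly one of "same row", "same column" holds).
rookAdj : (n : ℕ) → Mat n
rookAdj n v w = b2z (sameRow v w xor sameCol v w)

rookCompAdj : (n : ℕ) → Mat n
rookCompAdj n v w = b2z (not (sameRow v w) ∧ not (sameCol v w))

degree : ∀ {n} → Mat n → Vertex n → ℤ
degree A v = sumV (A v)

laplacian : ∀ {n} → Mat n → Mat n
laplacian A v w = (if eqV v w then degree A v else 0ℤ) - A v w

InIm : ∀ {n} → Mat n → Vec n → Set
InIm {n} M y = Σ (Vec n) (λ x → ∀ v → y v ≡ apply M x v)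

CokerEq : ∀ {n} → Mat n → Vec n → Vec n → Set
CokerEq M x y = InIm M (x -ᵥ y)

IsTorsion : ∀ {n} → Mat n → Vec n → Set
IsTorsion M x = Σ ℕ (λ k → InIm M (scale (+ suc k) x))

-- The finite abelian group ⊕_i ℤ/d_iℤ for a list of moduli ds,
-- with carrier ℤ^(length ds) modulo componentwise congruence.
Cyc : List ℕ → Set
Cyc ds = Fin (length ds) → ℤ

CycEq : (ds : List ℕ) → Cyc ds → Cyc ds → Set
CycEq ds x y = ∀ i → (+ lookup ds i) ∣ (x i - y i)

_+ᶜ_ : ∀ {ds} → Cyc ds → Cyc ds → Cyc ds
(x +ᶜ y) i = x i + y i

-- f is an isomorphism from the subgroup {x | P x} of the group (A, ≈A, +A)
-- onto the group (B, ≈B, +B) (groups given as setoids with an operation).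
record IsSubgroupIso {A B : Set} (P : A → Set)
    (_≈A_ : A → A → Set) (_+A_ : A → A → A)
    (_≈B_ : B → B → Set) (_+B_ : B → B → B) (f : A → B) : Set where
  field
    well-defined : ∀ {x y} → P x → P y → x ≈A y → f x ≈B f y
    homomorphism : ∀ {x y} → P x → P y → f (x +A y) ≈B (f x +B f y)
    injective    : ∀ {x y} → P x → P y → f x ≈B f y → x ≈A y
    surjective   : ∀ z → Σ A (λ x → P x × (f x ≈B z))

-- K(Γ) ≅ ⊕ ℤ/d_iℤ, where A is the adjacency matrix of Γ:
-- the torsion subgroup of coker(L) is isomorphic to ⊕ ℤ/d_iℤ.
CriticalGroupIso : ∀ {n} → Mat n → List ℕ → Set
CriticalGroupIso {n} A ds =
  Σ (Vec n → Cyc ds) (λ f →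
    IsSubgroupIso (IsTorsion (laplacian A)) (CokerEq (laplacian A)) _+ᵥ_
                  (CycEq ds) (_+ᶜ_ {ds}) f)

-- S(Γ) ≅ ⊕ ℤ/d_iℤ: coker(A) is isomorphic to ⊕ ℤ/d_iℤ.
SmithGroupIso : ∀ {n} → Mat n → List ℕ → Set
SmithGroupIso {n} A ds =
  Σ (Vec n → Cyc ds) (λ f →
    IsSubgroupIso (λ _ → ⊤) (CokerEq A) _+ᵥ_ (CycEq ds) (_+ᶜ_ {ds}) f)

-- All four matrices lie in the commutative algebra of operators
-- x ↦ α x + β (row sums + column sums) + γ (total sum) on ℤ^(n×n). For each group we write down
-- integer linear functionals φ_q (mixed differences x_ij - x_i0 - x_0j + x_00, row and column
-- differences corrected by entries of row and column 0, and one or two global combinations) with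
-- φ_q ≡ 0 mod d_q on the image. Together they give a homomorphism onto ⊕ ℤ/d_q: explicit vectors
-- realise any prescribed values. For injectivity, the conditions d_q ∣ φ_q x spread to all squares
-- through row and column sums and make B x divisible by D, for an operator B of the algebra with
-- M B = D; hence x = M (B x / D). For the Laplacians this runs on the vectors of total sum zero,
-- which are exactly the torsion elements of the cokernel.

module Submission where

open import Data.Nat using (ℕ; suc)

module FinSum where

  open import Defs
  open import Data.Nat using (zero; suc)
  open import Data.Integer using (ℤ; +_; _-_; _*_; _+_; 0ℤ; 1ℤ; -_)
  import Data.Integer.Properties as ℤP
  open import Data.Integer.Divisibility.Signed using (_∣_; divides; ∣m∣n⇒∣m+n)
  open import Data.Fin using (Fin; zero; suc)
  open import Data.Fin.Properties using (_≟_)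
  open import Relation.Nullary using (yes; no)
  open import Relation.Nullary.Decidable using (⌊_⌋)
  open import Relation.Binary.PropositionalEquality
  open import Data.Integer.Tactic.RingSolver using (solve-∀)

  sumFin-cong : ∀ {m} {f g : Fin m → ℤ} → (∀ i → f i ≡ g i) → sumFin f ≡ sumFin g
  sumFin-cong {zero}  h = refl
  sumFin-cong {suc m} h = cong₂ _+_ (h zero) (sumFin-cong (λ i → h (suc i)))

  sumFin-+ : ∀ {m} (f g : Fin m → ℤ) → sumFin (λ i → f i + g i) ≡ sumFin f + sumFin g
  sumFin-+ {zero}  f g = refl
  sumFin-+ {suc m} f g =
    trans (cong (_+_ (f zero + g zero)) (sumFin-+ (λ i → f (suc i)) (λ i → g (suc i))))
          (interchange (f zero) (g zero) _ _)
    where interchange : ∀ a b c d → a + b + (c + d) ≡ a + c + (b + d)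
          interchange = solve-∀

  sumFin-*ˡ : ∀ {m} (a : ℤ) (f : Fin m → ℤ) → sumFin (λ i → a * f i) ≡ a * sumFin f
  sumFin-*ˡ {zero}  a f = sym (ℤP.*-zeroʳ a)
  sumFin-*ˡ {suc m} a f =
    trans (cong (_+_ (a * f zero)) (sumFin-*ˡ a (λ i → f (suc i))))
          (sym (ℤP.*-distribˡ-+ a (f zero) _))

  sumFin-neg : ∀ {m} (f : Fin m → ℤ) → sumFin (λ i → - f i) ≡ - sumFin f
  sumFin-neg {zero}  f = refl
  sumFin-neg {suc m} f =
    trans (cong (_+_ (- f zero)) (sumFin-neg (λ i → f (suc i))))
          (sym (ℤP.neg-distrib-+ (f zero) _))

  sumFin-- : ∀ {m} (f g : Fin m → ℤ) → sumFin (λ i → f i - g i) ≡ sumFin f - sumFin g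
  sumFin-- f g = trans (sumFin-+ f (λ i → - g i)) (cong (_+_ (sumFin f)) (sumFin-neg g))

  sumFin-const : ∀ {m} (a : ℤ) → sumFin {m} (λ _ → a) ≡ + m * a
  sumFin-const {zero}  a = refl
  sumFin-const {suc m} a = trans (cong (_+_ a) (sumFin-const {m} a)) (count (+ m) a)
    where count : ∀ m a → a + m * a ≡ (1ℤ + m) * a
          count = solve-∀

  sumFin-zero : ∀ {m} → sumFin {m} (λ _ → 0ℤ) ≡ 0ℤ
  sumFin-zero {m} = trans (sumFin-const {m} 0ℤ) (ℤP.*-zeroʳ (+ m))

  sumFin-swap : ∀ {m p} (f : Fin m → Fin p → ℤ) →
    sumFin (λ i → sumFin (λ j → f i j)) ≡ sumFin (λ j → sumFin (λ i → f i j))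
  sumFin-swap {zero}  {p} f = sym (sumFin-zero {p})
  sumFin-swap {suc m}     f =
    trans (cong (_+_ (sumFin (f zero))) (sumFin-swap (λ i j → f (suc i) j)))
          (sym (sumFin-+ (f zero) (λ j → sumFin (λ i → f (suc i) j))))

  sumFin-∣ : ∀ {m} {d : ℤ} (f : Fin m → ℤ) → (∀ i → d ∣ f i) → d ∣ sumFin f
  sumFin-∣ {zero}  f h = divides 0ℤ refl
  sumFin-∣ {suc m} f h = ∣m∣n⇒∣m+n (h zero) (sumFin-∣ (λ i → f (suc i)) (λ i → h (suc i)))

  δ : ∀ {m} → Fin m → Fin m → ℤ
  δ i k = b2z ⌊ i ≟ k ⌋

  δ-suc : ∀ {m} (i k : Fin m) → δ (suc i) (suc k) ≡ δ i k
  δ-suc i k with i ≟ k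
  ... | yes _ = refl
  ... | no  _ = refl

  sumFin-δ : ∀ {m} (i : Fin m) (f : Fin m → ℤ) → sumFin (λ k → δ i k * f k) ≡ f i
  sumFin-δ {suc m} zero f =
    trans (cong (_+_ (1ℤ * f zero))
                (trans (sumFin-cong (λ k → ℤP.*-zeroˡ (f (suc k)))) (sumFin-zero {m})))
          (trans (ℤP.+-identityʳ _) (ℤP.*-identityˡ _))
  sumFin-δ {suc m} (suc i) f =
    trans (cong (_+ sumFin (λ k → δ (suc i) (suc k) * f (suc k))) (ℤP.*-zeroˡ (f zero)))
          (trans (ℤP.+-identityˡ _)
                 (trans (sumFin-cong (λ k → cong (_* f (suc k)) (δ-suc i k)))
                        (sumFin-δ i (λ k → f (suc k)))))

module IntDivisibility where

  open import Data.Integer using (ℤ; _*_; 0ℤ)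
  import Data.Integer.Properties as ℤP
  open import Data.Integer.Divisibility.Signed using (_∣_; divides)
  open import Relation.Binary.PropositionalEquality using (_≡_; sym; subst)

  ∣0 : ∀ {a} → a ∣ 0ℤ
  ∣0 {a} = divides 0ℤ (sym (ℤP.*-zeroˡ a))

  ∣-respʳ : ∀ {a b c} → b ≡ c → a ∣ b → a ∣ c
  ∣-respʳ {a} = subst (a ∣_)

  ∣-respˡ : ∀ {a a′ b} → a ≡ a′ → a ∣ b → a′ ∣ b
  ∣-respˡ {b = b} = subst (_∣ b)

  divides′ : ∀ {a a′ b} → a ≡ a′ → ∀ q → b ≡ q * a′ → a ∣ b
  divides′ {b = b} a≡a′ q eq = subst (_∣ b) (sym a≡a′) (divides q eq)

  ∣-map : ∀ {a b a′ b′} (f : ℤ → ℤ) → (∀ q → b ≡ q * a → b′ ≡ f q * a′) → a ∣ b → a′ ∣ b′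
  ∣-map f g (divides q eq) = divides (f q) (g q eq)

  ∣-map₂ : ∀ {a b c e a′ b′} (f : ℤ → ℤ → ℤ) →
    (∀ q → b ≡ q * a → ∀ q′ → e ≡ q′ * c → b′ ≡ f q q′ * a′) → a ∣ b → c ∣ e → a′ ∣ b′
  ∣-map₂ f g (divides q eq) (divides q′ eq′) = divides (f q q′) (g q eq q′ eq′)

module DirectSum where

  open import Defs
  open import Data.Nat using (ℕ; suc)
  open import Data.Integer using (ℤ; +_; _-_; _+_; 0ℤ)
  import Data.Integer.Properties as ℤP
  import Data.Integer.Divisibility as Unsigned
  open import Data.Integer.Divisibility.Signed using (_∣_; divides; ∣ᵤ⇒∣; ∣⇒∣ᵤ)
  open import Data.Fin using (Fin; zero; suc)
  open import Data.Fin.Properties using (1↔⊤)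
  open import Data.List using (List; []; _∷_; length; lookup; replicate; _++_; [_])
  open import Data.List.Properties using (length-replicate)
  open import Data.Sum using (_⊎_; inj₁; inj₂; [_,_]′)
  import Data.Sum as Sum
  open import Data.Product using (Σ; _×_; _,_)
  open import Data.Unit using (⊤)
  open import Function using (const)
  open import Function.Bundles using (_↔_; Inverse; mk↔ₛ′)
  open import Function.Properties.Inverse using (↔-refl; ↔-trans)
  open import Data.Sum.Function.Propositional using (_⊎-↔_)
  open import Relation.Binary.PropositionalEquality using (_≡_; refl; sym; trans; cong; subst)
  open import Data.Integer.Tactic.RingSolver using (solve-∀)

  open Inverse

  Fin-cast↔ : ∀ {a b} → a ≡ b → Fin a ↔ Fin b
  Fin-cast↔ refl = ↔-refl

  module _ {A : Set} where

    splitAt++ : ∀ (xs ys : List A) → Fin (length (xs ++ ys)) → Fin (length xs) ⊎ Fin (length ys)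
    splitAt++ []       ys i       = inj₂ i
    splitAt++ (x ∷ xs) ys zero    = inj₁ zero
    splitAt++ (x ∷ xs) ys (suc i) = Sum.map₁ suc (splitAt++ xs ys i)

    join++ : ∀ (xs ys : List A) → Fin (length xs) ⊎ Fin (length ys) → Fin (length (xs ++ ys))
    join++ []       ys (inj₂ j)       = j
    join++ (x ∷ xs) ys (inj₁ zero)    = zero
    join++ (x ∷ xs) ys (inj₁ (suc i)) = suc (join++ xs ys (inj₁ i))
    join++ (x ∷ xs) ys (inj₂ j)       = suc (join++ xs ys (inj₂ j))

    splitAt++-join++ : ∀ xs ys j → splitAt++ xs ys (join++ xs ys j) ≡ j
    splitAt++-join++ []       ys (inj₂ j)       = refl
    splitAt++-join++ (x ∷ xs) ys (inj₁ zero)    = refl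
    splitAt++-join++ (x ∷ xs) ys (inj₁ (suc i)) = cong (Sum.map₁ suc) (splitAt++-join++ xs ys (inj₁ i))
    splitAt++-join++ (x ∷ xs) ys (inj₂ j)       = cong (Sum.map₁ suc) (splitAt++-join++ xs ys (inj₂ j))

    join++-splitAt++ : ∀ xs ys i → join++ xs ys (splitAt++ xs ys i) ≡ i
    join++-splitAt++ []       ys i       = refl
    join++-splitAt++ (x ∷ xs) ys zero    = refl
    join++-splitAt++ (x ∷ xs) ys (suc i) with splitAt++ xs ys i | join++-splitAt++ xs ys i
    ... | inj₁ _ | eq = cong suc eq
    ... | inj₂ _ | eq = cong suc eq

    ++↔⊎ : ∀ xs ys → Fin (length (xs ++ ys)) ↔ (Fin (length xs) ⊎ Fin (length ys))
    ++↔⊎ xs ys = mk↔ₛ′ (splitAt++ xs ys) (join++ xs ys) (splitAt++-join++ xs ys) (join++-splitAt++ xs ys)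

    lookup-++ : ∀ xs ys i → lookup (xs ++ ys) i ≡ [ lookup xs , lookup ys ]′ (splitAt++ xs ys i)
    lookup-++ []       ys i       = refl
    lookup-++ (x ∷ xs) ys zero    = refl
    lookup-++ (x ∷ xs) ys (suc i) with splitAt++ xs ys i | lookup-++ xs ys i
    ... | inj₁ _ | eq = eq
    ... | inj₂ _ | eq = eq

  lookup-replicate′ : ∀ b (c : ℕ) j → lookup (replicate b c) j ≡ c
  lookup-replicate′ (suc b) c zero    = refl
  lookup-replicate′ (suc b) c (suc j) = lookup-replicate′ b c j

  record Enumerates {I : Set} (d : I → ℕ) (ds : List ℕ) : Set where
    constructor enumerates
    field
      enumeration : Fin (length ds) ↔ I
      lookup≡     : ∀ i → lookup ds i ≡ d (to enumeration i)

  enumerates-[_] : ∀ c → Enumerates {⊤} (const c) [ c ]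
  enumerates-[ c ] = enumerates 1↔⊤ λ { zero → refl }

  enumerates-replicate : ∀ {I} b c → Fin b ↔ I → Enumerates {I} (const c) (replicate b c)
  enumerates-replicate b c e = enumerates (↔-trans (Fin-cast↔ (length-replicate b)) e) (lookup-replicate′ b c)

  enumerates-++ : ∀ {I J} {d : I → ℕ} {d′ : J → ℕ} {xs ys} →
    Enumerates d xs → Enumerates d′ ys → Enumerates [ d , d′ ]′ (xs ++ ys)
  enumerates-++ {d = d} {d′} {xs} {ys} (enumerates e coh) (enumerates e′ coh′) =
    enumerates (↔-trans (++↔⊎ xs ys) (e ⊎-↔ e′)) λ i → trans (lookup-++ xs ys i) (coh-⊎ (splitAt++ xs ys i))
    where
      coh-⊎ : ∀ j → [ lookup xs , lookup ys ]′ j ≡ [ d , d′ ]′ (Sum.map (to e) (to e′) j)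
      coh-⊎ (inj₁ i) = coh i
      coh-⊎ (inj₂ i) = coh′ i

  module FromInvariants
    {n : ℕ} (M : Mat n) (P : Vec n → Set) {I : Set} (d : I → ℕ) {ds : List ℕ}
    (enum : Enumerates d ds) (φ : I → Vec n → ℤ)
    (φ-cong : ∀ q {x y : Vec n} → (∀ v → x v ≡ y v) → φ q x ≡ φ q y)
    (φ-+ : ∀ q x y → φ q (x +ᵥ y) ≡ φ q x + φ q y)
    (φ-image : ∀ q z → + d q ∣ φ q (apply M z))
    (φ-kernel : ∀ {x y} → P x → P y → (∀ q → + d q ∣ φ q (x -ᵥ y)) → InIm M (x -ᵥ y))
    (φ-onto : ∀ (z : I → ℤ) → Σ (Vec n) λ x → P x × (∀ q → + d q ∣ φ q x - z q))
    where

    open Enumerates enum renaming (enumeration to e; lookup≡ to coh)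

    φ-- : ∀ q x y → φ q (x -ᵥ y) ≡ φ q x - φ q y
    φ-- q x y = sym (trans (cong (_- φ q y) (trans (φ-cong q (λ v → sym (sub-add (x v) (y v))))
                                                   (φ-+ q (x -ᵥ y) y)))
                           (add-sub (φ q (x -ᵥ y)) (φ q y)))
      where sub-add : ∀ a b → a - b + b ≡ a
            sub-add = solve-∀
            add-sub : ∀ a b → a + b - b ≡ a
            add-sub = solve-∀

    toCyc : Vec n → Cyc ds
    toCyc x i = φ (to e i) x

    ∣-lookup : ∀ i {a} → + d (to e i) ∣ a → + lookup ds i Unsigned.∣ a
    ∣-lookup i h rewrite coh i = ∣⇒∣ᵤ h

    ∣-index : ∀ q (g : I → ℤ) → + lookup ds (from e q) Unsigned.∣ g (to e (from e q)) → + d q ∣ g q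
    ∣-index q g h = subst (λ t → + d t ∣ g t) (strictlyInverseˡ e q)
                          (subst (λ t → + t ∣ g (to e (from e q))) (coh (from e q)) (∣ᵤ⇒∣ h))

    isoDirectSum : Σ (Vec n → Cyc ds) (IsSubgroupIso P (CokerEq M) _+ᵥ_ (CycEq ds) (_+ᶜ_ {ds}))
    isoDirectSum = toCyc , record
      { well-defined = λ {x} {y} _ _ (z , x-y≡Mz) i → ∣-lookup i
          (subst (+ d (to e i) ∣_) (trans (sym (φ-cong (to e i) x-y≡Mz)) (φ-- (to e i) x y))
                 (φ-image (to e i) z))
      ; homomorphism = λ {x} {y} _ _ i → ∣-lookup i
          (divides 0ℤ (trans (cong (_- (φ (to e i) x + φ (to e i) y)) (φ-+ (to e i) x y))
                             (ℤP.+-inverseʳ (φ (to e i) x + φ (to e i) y))))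
      ; injective = λ {x} {y} px py h → φ-kernel px py λ q → ∣-index q (λ t → φ t (x -ᵥ y))
          (subst (+ lookup ds (from e q) Unsigned.∣_) (sym (φ-- (to e (from e q)) x y)) (h (from e q)))
      ; surjective = λ z → let (x , px , hx) = φ-onto (λ q → z (from e q)) in
          x , px , λ i → ∣-lookup i
            (subst (λ t → + d (to e i) ∣ φ (to e i) x - z t) (strictlyInverseʳ e i) (hx (to e i)))
      }

module RookOperator {n : ℕ} where

  open import Defs
  open FinSum
  open import Data.Integer using (ℤ; +_; _-_; _*_; _+_; 0ℤ; 1ℤ; -_)
  import Data.Integer.Properties as ℤP
  open import Data.Fin using (Fin)
  open import Data.Fin.Properties using (_≟_)
  open import Data.Bool using (true; false; if_then_else_; _∧_; _xor_; not)
  open import Data.Product using (_,_)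
  open import Relation.Nullary.Decidable using (⌊_⌋)
  open import Relation.Binary.PropositionalEquality using (_≡_; refl; sym; trans; cong; cong₂)
  open import Data.Integer.Tactic.RingSolver using (solve-∀)

  N : ℤ
  N = + n

  row col : Vec n → Fin n → ℤ
  row x i = sumFin (λ l → x (i , l))
  col x j = sumFin (λ k → x (k , j))

  tot : Vec n → ℤ
  tot x = sumV x

  rookOp : ℤ → ℤ → ℤ → Vec n → Vec n
  rookOp α β γ x (i , j) = α * x (i , j) + β * (row x i + col x j) + γ * tot x

  onesEigenvalue : ℤ → ℤ → ℤ → ℤ
  onesEigenvalue α β γ = α + β * N + β * N + γ * N * N

  tot≡sum-col : ∀ x → tot x ≡ sumFin (col x)
  tot≡sum-col x = sumFin-swap (λ k l → x (k , l))

  module _ {x y : Vec n} (x≗y : ∀ v → x v ≡ y v) where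

    row-cong : ∀ i → row x i ≡ row y i
    row-cong i = sumFin-cong (λ l → x≗y (i , l))

    col-cong : ∀ j → col x j ≡ col y j
    col-cong j = sumFin-cong (λ k → x≗y (k , j))

    tot-cong : tot x ≡ tot y
    tot-cong = sumFin-cong row-cong

    rookOp-cong : ∀ α β γ v → rookOp α β γ x v ≡ rookOp α β γ y v
    rookOp-cong α β γ (i , j) =
      cong₂ _+_ (cong₂ _+_ (cong (α *_) (x≗y (i , j))) (cong (β *_) (cong₂ _+_ (row-cong i) (col-cong j))))
                (cong (γ *_) tot-cong)

  row-+ : ∀ x y i → row (x +ᵥ y) i ≡ row x i + row y i
  row-+ x y i = sumFin-+ (λ l → x (i , l)) (λ l → y (i , l))

  col-+ : ∀ x y j → col (x +ᵥ y) j ≡ col x j + col y j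
  col-+ x y j = sumFin-+ (λ k → x (k , j)) (λ k → y (k , j))

  tot-+ : ∀ x y → tot (x +ᵥ y) ≡ tot x + tot y
  tot-+ x y = trans (sumFin-cong (row-+ x y)) (sumFin-+ (row x) (row y))

  row-- : ∀ x y i → row (x -ᵥ y) i ≡ row x i - row y i
  row-- x y i = sumFin-- (λ l → x (i , l)) (λ l → y (i , l))

  col-- : ∀ x y j → col (x -ᵥ y) j ≡ col x j - col y j
  col-- x y j = sumFin-- (λ k → x (k , j)) (λ k → y (k , j))

  tot-- : ∀ x y → tot (x -ᵥ y) ≡ tot x - tot y
  tot-- x y = trans (sumFin-cong (row-- x y)) (sumFin-- (row x) (row y))

  row-*ʳ : ∀ (D : ℤ) x i → row (λ w → x w * D) i ≡ row x i * D
  row-*ʳ D x i = trans (sumFin-cong (λ l → ℤP.*-comm (x (i , l)) D))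
                       (trans (sumFin-*ˡ D (λ l → x (i , l))) (ℤP.*-comm D _))

  col-*ʳ : ∀ (D : ℤ) x j → col (λ w → x w * D) j ≡ col x j * D
  col-*ʳ D x j = trans (sumFin-cong (λ k → ℤP.*-comm (x (k , j)) D))
                       (trans (sumFin-*ˡ D (λ k → x (k , j))) (ℤP.*-comm D _))

  tot-*ʳ : ∀ (D : ℤ) x → tot (λ w → x w * D) ≡ tot x * D
  tot-*ʳ D x = trans (sumFin-cong (row-*ʳ D x))
                     (trans (sumFin-cong (λ i → ℤP.*-comm (row x i) D))
                            (trans (sumFin-*ˡ D (row x)) (ℤP.*-comm D _)))

  tot-scale : ∀ (c : ℤ) x → tot (scale c x) ≡ c * tot x
  tot-scale c x = trans (sumFin-cong (λ i → sumFin-*ˡ c (λ l → x (i , l)))) (sumFin-*ˡ c (row x))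

  private
    sum-affine : ∀ {m} (a b c u : ℤ) (f g : Fin m → ℤ) →
      sumFin (λ l → a * f l + b * (u + g l) + c) ≡ a * sumFin f + b * (+ m * u + sumFin g) + + m * c
    sum-affine {m} a b c u f g =
      trans (sumFin-+ (λ l → a * f l + b * (u + g l)) (λ _ → c))
            (cong₂ _+_ (trans (sumFin-+ (λ l → a * f l) (λ l → b * (u + g l)))
                              (cong₂ _+_ (sumFin-*ˡ a f)
                                         (trans (sumFin-*ˡ b (λ l → u + g l))
                                                (cong (b *_) (trans (sumFin-+ (λ _ → u) g)
                                                                    (cong (_+ sumFin g) (sumFin-const {m} u)))))))
                       (sumFin-const {m} c))

  row-rookOp : ∀ α β γ x i → row (rookOp α β γ x) i ≡ (α + β * N) * row x i + (β + γ * N) * tot x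
  row-rookOp α β γ x i =
    trans (sum-affine α β (γ * tot x) (row x i) (λ l → x (i , l)) (col x))
          (trans (cong (λ t → α * row x i + β * (N * row x i + t) + N * (γ * tot x)) (sym (tot≡sum-col x)))
                 (collect α β γ (row x i) (tot x) N))
    where collect : ∀ α β γ a s N → α * a + β * (N * a + s) + N * (γ * s) ≡ (α + β * N) * a + (β + γ * N) * s
          collect = solve-∀

  col-rookOp : ∀ α β γ x j → col (rookOp α β γ x) j ≡ (α + β * N) * col x j + (β + γ * N) * tot x
  col-rookOp α β γ x j =
    trans (sumFin-cong (λ k → cong (λ t → α * x (k , j) + β * t + γ * tot x) (ℤP.+-comm (row x k) (col x j))))
          (trans (sum-affine α β (γ * tot x) (col x j) (λ k → x (k , j)) (row x))
                 (collect α β γ (col x j) (tot x) N))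
    where collect : ∀ α β γ a s N → α * a + β * (N * a + s) + N * (γ * s) ≡ (α + β * N) * a + (β + γ * N) * s
          collect = solve-∀

  tot-rookOp : ∀ α β γ x → tot (rookOp α β γ x) ≡ onesEigenvalue α β γ * tot x
  tot-rookOp α β γ x =
    trans (sumFin-cong (row-rookOp α β γ x))
          (trans (sumFin-+ (λ i → (α + β * N) * row x i) (λ _ → (β + γ * N) * tot x))
                 (trans (cong₂ _+_ (sumFin-*ˡ (α + β * N) (row x)) (sumFin-const {n} ((β + γ * N) * tot x)))
                        (collect α β γ (tot x) N)))
    where collect : ∀ α β γ s N → (α + β * N) * s + N * ((β + γ * N) * s) ≡ (α + β * N + β * N + γ * N * N) * s
          collect = solve-∀

  rookOp-*ʳ : ∀ α β γ (D : ℤ) x v → rookOp α β γ (λ w → x w * D) v ≡ rookOp α β γ x v * D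
  rookOp-*ʳ α β γ D x (i , j) =
    trans (cong₂ _+_ (cong (λ t → α * (x (i , j) * D) + β * t) (cong₂ _+_ (row-*ʳ D x i) (col-*ʳ D x j)))
                     (cong (γ *_) (tot-*ʳ D x)))
          (collect α β γ D (x (i , j)) (row x i) (col x j) (tot x))
    where collect : ∀ α β γ D X R C S → α * (X * D) + β * (R * D + C * D) + γ * (S * D) ≡ (α * X + β * (R + C) + γ * S) * D
          collect = solve-∀

  rookOp-- : ∀ α β γ x y v → rookOp α β γ (x -ᵥ y) v ≡ rookOp α β γ x v - rookOp α β γ y v
  rookOp-- α β γ x y (i , j) =
    trans (cong₂ _+_ (cong (λ t → α * (x (i , j) - y (i , j)) + β * t) (cong₂ _+_ (row-- x y i) (col-- x y j)))
                     (cong (γ *_) (tot-- x y)))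
          (collect α β γ (x (i , j)) (y (i , j)) (row x i) (row y i) (col x j) (col y j) (tot x) (tot y))
    where collect : ∀ α β γ X Y R R′ C C′ S S′ → α * (X - Y) + β * (R - R′ + (C - C′)) + γ * (S - S′) ≡
                      α * X + β * (R + C) + γ * S - (α * Y + β * (R′ + C′) + γ * S′)
          collect = solve-∀

  rookOp-const : ∀ α β γ (c : ℤ) v → rookOp α β γ (λ _ → c) v ≡ onesEigenvalue α β γ * c
  rookOp-const α β γ c (i , j) =
    trans (cong₂ (λ s t → α * c + β * s + γ * t)
                 (cong₂ _+_ (sumFin-const {n} c) (sumFin-const {n} c))
                 (trans (sumFin-cong {n} (λ _ → sumFin-const {n} c)) (sumFin-const {n} (N * c))))
          (collect α β γ c N)
    where collect : ∀ α β γ c N → α * c + β * (N * c + N * c) + γ * (N * (N * c)) ≡ (α + β * N + β * N + γ * N * N) * c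
          collect = solve-∀

  rookOp-∘ : ∀ α β γ α′ β′ γ′ x i j → rookOp α β γ (rookOp α′ β′ γ′ x) (i , j) ≡
    α * α′ * x (i , j) + (α * β′ + β * (α′ + β′ * N)) * (row x i + col x j)
      + (α * γ′ + (β + β) * (β′ + γ′ * N) + γ * onesEigenvalue α′ β′ γ′) * tot x
  rookOp-∘ α β γ α′ β′ γ′ x i j =
    trans (cong₂ _+_ (cong (λ t → α * rookOp α′ β′ γ′ x (i , j) + β * t)
                           (cong₂ _+_ (row-rookOp α′ β′ γ′ x i) (col-rookOp α′ β′ γ′ x j)))
                     (cong (γ *_) (tot-rookOp α′ β′ γ′ x)))
          (collect α β γ α′ β′ γ′ N (x (i , j)) (row x i) (col x j) (tot x))
    where collect : ∀ α β γ α′ β′ γ′ N X R C S →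
            α * (α′ * X + β′ * (R + C) + γ′ * S)
              + β * ((α′ + β′ * N) * R + (β′ + γ′ * N) * S + ((α′ + β′ * N) * C + (β′ + γ′ * N) * S))
              + γ * ((α′ + β′ * N + β′ * N + γ′ * N * N) * S) ≡
            α * α′ * X + (α * β′ + β * (α′ + β′ * N)) * (R + C)
              + (α * γ′ + (β + β) * (β′ + γ′ * N) + γ * (α′ + β′ * N + β′ * N + γ′ * N * N)) * S
          collect = solve-∀

  record WeightForm (M : Mat n) (a b c : ℤ) : Set where
    field entry : ∀ i j k l → M (i , j) (k , l) ≡ a * (δ i k * δ j l) + b * (δ i k + δ j l) + c
  open WeightForm

  apply-weightForm : ∀ {M a b c} → WeightForm M a b c → ∀ x v → apply M x v ≡ rookOp a b c x v
  apply-weightForm {M} {a} {b} {c} wf x (i , j) =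
    trans (sumFin-cong (λ k → trans (sumFin-cong (λ l → cong (_* x (k , l)) (entry wf i j k l))) (sum-row k)))
          (trans (sumFin-cong (λ k → regroup (δ i k) a b c (x (k , j)) (row x k)))
                 (trans (sumFin-+ (λ k → δ i k * (a * x (k , j) + b * row x k)) (λ k → b * x (k , j) + c * row x k))
                        (trans (cong₂ _+_ (sumFin-δ i (λ k → a * x (k , j) + b * row x k))
                                          (trans (sumFin-+ (λ k → b * x (k , j)) (λ k → c * row x k))
                                                 (cong₂ _+_ (sumFin-*ˡ b (λ k → x (k , j))) (sumFin-*ˡ c (row x)))))
                               (collect a b c (x (i , j)) (row x i) (col x j) (tot x)))))
    where
      split : ∀ p q a b c X → (a * (p * q) + b * (p + q) + c) * X ≡ q * ((a * p + b) * X) + (b * p + c) * X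
      split = solve-∀
      regroup : ∀ p a b c X R → (a * p + b) * X + (b * p + c) * R ≡ p * (a * X + b * R) + (b * X + c * R)
      regroup = solve-∀
      collect : ∀ a b c X R C S → a * X + b * R + (b * C + c * S) ≡ a * X + b * (R + C) + c * S
      collect = solve-∀
      sum-row : ∀ k → sumFin (λ l → (a * (δ i k * δ j l) + b * (δ i k + δ j l) + c) * x (k , l))
                      ≡ (a * δ i k + b) * x (k , j) + (b * δ i k + c) * row x k
      sum-row k =
        trans (sumFin-cong (λ l → split (δ i k) (δ j l) a b c (x (k , l))))
              (trans (sumFin-+ (λ l → δ j l * ((a * δ i k + b) * x (k , l))) (λ l → (b * δ i k + c) * x (k , l)))
                     (cong₂ _+_ (sumFin-δ j (λ l → (a * δ i k + b) * x (k , l)))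
                                (sumFin-*ˡ (b * δ i k + c) (λ l → x (k , l)))))

  degree-weightForm : ∀ {M a b c} → WeightForm M a b c → ∀ v → degree M v ≡ onesEigenvalue a b c
  degree-weightForm {M} {a} {b} {c} wf (i , j) =
    trans (sumFin-cong (λ k → sumFin-cong (λ l → sym (ℤP.*-identityʳ (M (i , j) (k , l))))))
          (trans (apply-weightForm wf (λ _ → 1ℤ) (i , j))
                 (trans (rookOp-const a b c 1ℤ (i , j)) (ℤP.*-identityʳ _)))

  laplacian-weightForm : ∀ {M a b c} → WeightForm M a b c →
    WeightForm (laplacian M) (onesEigenvalue a b c - a) (- b) (- c)
  laplacian-weightForm {M} {a} {b} {c} wf .entry i j k l =
    trans (cong₂ _-_ (trans (if-∧ ⌊ i ≟ k ⌋ ⌊ j ≟ l ⌋ (degree M (i , j)))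
                            (cong (_* (δ i k * δ j l)) (degree-weightForm wf (i , j))))
                     (entry wf i j k l))
          (collect (onesEigenvalue a b c) a b c (δ i k * δ j l) (δ i k) (δ j l))
    where
      if-∧ : ∀ p q X → (if p ∧ q then X else 0ℤ) ≡ X * (b2z p * b2z q)
      if-∧ true  true  X = sym (ℤP.*-identityʳ X)
      if-∧ true  false X = sym (ℤP.*-zeroʳ X)
      if-∧ false true  X = sym (ℤP.*-zeroʳ X)
      if-∧ false false X = sym (ℤP.*-zeroʳ X)
      collect : ∀ D a b c e p q → D * e - (a * e + b * (p + q) + c) ≡ (D - a) * e + (- b) * (p + q) + (- c)
      collect = solve-∀

  rookAdj-weightForm : WeightForm (rookAdj n) (- + 2) 1ℤ 0ℤ
  rookAdj-weightForm .entry i j k l = xor-weights ⌊ i ≟ k ⌋ ⌊ j ≟ l ⌋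
    where xor-weights : ∀ p q → b2z (p xor q) ≡ (- + 2) * (b2z p * b2z q) + 1ℤ * (b2z p + b2z q) + 0ℤ
          xor-weights true  true  = refl
          xor-weights true  false = refl
          xor-weights false true  = refl
          xor-weights false false = refl

  rookCompAdj-weightForm : WeightForm (rookCompAdj n) 1ℤ (- 1ℤ) 1ℤ
  rookCompAdj-weightForm .entry i j k l = nor-weights ⌊ i ≟ k ⌋ ⌊ j ≟ l ⌋
    where nor-weights : ∀ p q → b2z (not p ∧ not q) ≡ 1ℤ * (b2z p * b2z q) + (- 1ℤ) * (b2z p + b2z q) + 1ℤ
          nor-weights true  true  = refl
          nor-weights true  false = refl
          nor-weights false true  = refl
          nor-weights false false = refl

  apply-rookAdj : ∀ x v → apply (rookAdj n) x v ≡ rookOp (- + 2) 1ℤ 0ℤ x v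
  apply-rookAdj = apply-weightForm rookAdj-weightForm

  apply-rookCompAdj : ∀ x v → apply (rookCompAdj n) x v ≡ rookOp 1ℤ (- 1ℤ) 1ℤ x v
  apply-rookCompAdj = apply-weightForm rookCompAdj-weightForm

  apply-laplacian-rookAdj : ∀ x v → apply (laplacian (rookAdj n)) x v ≡ rookOp (N + N) (- 1ℤ) 0ℤ x v
  apply-laplacian-rookAdj x v =
    trans (apply-weightForm (laplacian-weightForm rookAdj-weightForm) x v)
          (cong (λ α → rookOp α (- 1ℤ) 0ℤ x v) (coeff N))
    where coeff : ∀ N → - + 2 + 1ℤ * N + 1ℤ * N + 0ℤ * N * N - - + 2 ≡ N + N
          coeff = solve-∀

  apply-laplacian-rookCompAdj : ∀ x v → apply (laplacian (rookCompAdj n)) x v ≡ rookOp (N * N - N - N) 1ℤ (- 1ℤ) x v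
  apply-laplacian-rookCompAdj x v =
    trans (apply-weightForm (laplacian-weightForm rookCompAdj-weightForm) x v)
          (cong (λ α → rookOp α 1ℤ (- 1ℤ) x v) (coeff N))
    where coeff : ∀ N → 1ℤ + (- 1ℤ) * N + (- 1ℤ) * N + 1ℤ * N * N - 1ℤ ≡ N * N - N - N
          coeff = solve-∀

module Image {n : ℕ} where

  open import Defs
  open RookOperator {n}
  open import Data.Integer using (ℤ; +_; _-_; _*_; 0ℤ; NonZero)
  import Data.Integer.Properties as ℤP
  open import Data.Integer.Divisibility.Signed using (_∣_; divides; module _∣_)
  open import Data.Product using (_,_)
  open import Relation.Binary.PropositionalEquality using (_≡_; sym; trans; cong; cong₂; module ≡-Reasoning)

  module _ (M : Mat n) (α β γ : ℤ) (apply-M : ∀ x v → apply M x v ≡ rookOp α β γ x v) where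

    ∈-image-by-division : ∀ {D} .{{_ : NonZero D}} x (ψ : Vec n) →
      (∀ v → rookOp α β γ ψ v ≡ x v * D) → (∀ v → D ∣ ψ v) → InIm M x
    ∈-image-by-division {D} x ψ Mψ≡Dx D∣ψ = ψ/D , λ v → sym (ℤP.*-cancelʳ-≡ _ _ D (begin
        apply M ψ/D v * D                    ≡⟨ cong (_* D) (apply-M ψ/D v) ⟩
        rookOp α β γ ψ/D v * D               ≡⟨ rookOp-*ʳ α β γ D ψ/D v ⟨
        rookOp α β γ (λ w → ψ/D w * D) v     ≡⟨ rookOp-cong (λ w → _∣_.equality (D∣ψ w)) α β γ v ⟨
        rookOp α β γ ψ v                     ≡⟨ Mψ≡Dx v ⟩
        x v * D                              ∎))
      where
        open ≡-Reasoning
        ψ/D : Vec n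
        ψ/D v = _∣_.quotient (D∣ψ v)

    -- M kills constants, so on vectors of total 0 the near-inverse rookOp α′ β′ γ′ may be shifted
    -- by a constant; the invariants control its values only up to such a shift.
    module Laplacian (v₀ : Vertex n) (onesEigenvalue≡0 : onesEigenvalue α β γ ≡ 0ℤ) (α′ β′ γ′ D : ℤ)
      (rookOp-∘≡D : ∀ x → tot x ≡ 0ℤ → ∀ i j → rookOp α β γ (rookOp α′ β′ γ′ x) (i , j) ≡ x (i , j) * D) where

      centred : Vec n → Vec n
      centred x v = rookOp α′ β′ γ′ x v - rookOp α′ β′ γ′ x v₀

      rookOp-centred : ∀ x → tot x ≡ 0ℤ → ∀ v → rookOp α β γ (centred x) v ≡ x v * D
      rookOp-centred x tot≡0 (i , j) =
        trans (rookOp-- α β γ (rookOp α′ β′ γ′ x) (λ _ → c) (i , j))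
              (trans (cong₂ _-_ (rookOp-∘≡D x tot≡0 i j)
                                (trans (rookOp-const α β γ c (i , j))
                                       (trans (cong (_* c) onesEigenvalue≡0) (ℤP.*-zeroˡ c))))
                     (ℤP.+-identityʳ _))
        where c = rookOp α′ β′ γ′ x v₀

      ∈-image : ∀ .{{_ : NonZero D}} x → tot x ≡ 0ℤ → (∀ v → D ∣ centred x v) → InIm M x
      ∈-image x tot≡0 = ∈-image-by-division x (centred x) (rookOp-centred x tot≡0)

      tot≡0⇒torsion : ∀ {d} → D ≡ + suc d → ∀ x → tot x ≡ 0ℤ → IsTorsion M x
      tot≡0⇒torsion {d} D≡1+d x tot≡0 = d , centred x , λ v → sym (begin
          apply M (centred x) v          ≡⟨ apply-M (centred x) v ⟩
          rookOp α β γ (centred x) v     ≡⟨ rookOp-centred x tot≡0 v ⟩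
          x v * D                        ≡⟨ cong (x v *_) D≡1+d ⟩
          x v * + suc d                  ≡⟨ ℤP.*-comm (x v) (+ suc d) ⟩
          + suc d * x v                  ∎)
        where open ≡-Reasoning

      torsion⇒tot≡0 : ∀ x → IsTorsion M x → tot x ≡ 0ℤ
      torsion⇒tot≡0 x (t , y , kx≡My) = ℤP.*-cancelˡ-≡ (+ suc t) (tot x) 0ℤ (begin
          + suc t * tot x                         ≡⟨ tot-scale (+ suc t) x ⟨
          tot (scale (+ suc t) x)                 ≡⟨ tot-cong kx≡My ⟩
          tot (apply M y)                         ≡⟨ tot-cong (apply-M y) ⟩
          tot (rookOp α β γ y)                    ≡⟨ tot-rookOp α β γ y ⟩
          onesEigenvalue α β γ * tot y            ≡⟨ cong (_* tot y) onesEigenvalue≡0 ⟩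
          0ℤ * tot y                              ≡⟨ ℤP.*-zeroˡ (tot y) ⟩
          0ℤ                                      ≡⟨ ℤP.*-zeroʳ (+ suc t) ⟨
          + suc t * 0ℤ                            ∎)
        where open ≡-Reasoning

module Differences (k : ℕ) where

  open import Defs
  open FinSum
  open IntDivisibility
  open import Data.Integer using (ℤ; +_; _-_; _*_; _+_; 0ℤ)
  import Data.Integer.Properties as ℤP
  open import Data.Integer.Divisibility.Signed using (_∣_; ∣m∣n⇒∣m+n; ∣m∣n⇒∣m-n; ∣m⇒∣m*n)
  open import Data.Fin using (Fin; zero; suc)
  open import Data.Product using (_,_)
  open import Relation.Binary.PropositionalEquality using (_≡_; sym; trans; cong; cong₂)
  open import Data.Integer.Tactic.RingSolver using (solve-∀)

  n : ℕ
  n = suc (suc (suc k))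

  open RookOperator {n}

  inner : Fin (suc k) → Fin n
  inner p = suc (suc p)

  mixedDiff : Vec n → Fin n → Fin n → ℤ
  mixedDiff x i j = x (i , j) - x (i , zero) - x (zero , j) + x (zero , zero)

  colDiff rowDiff : ℤ → Vec n → Fin n → ℤ
  colDiff c x j = col x j - col x zero - c * (x (zero , j) - x (zero , zero))
  rowDiff c x i = row x i - row x zero - c * (x (i , zero) - x (zero , zero))

  module _ {x y : Vec n} (x≗y : ∀ v → x v ≡ y v) where

    mixedDiff-cong : ∀ i j → mixedDiff x i j ≡ mixedDiff y i j
    mixedDiff-cong i j =
      cong₂ _+_ (cong₂ _-_ (cong₂ _-_ (x≗y (i , j)) (x≗y (i , zero))) (x≗y (zero , j))) (x≗y (zero , zero))

    colDiff-cong : ∀ c j → colDiff c x j ≡ colDiff c y j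
    colDiff-cong c j = cong₂ _-_ (cong₂ _-_ (col-cong x≗y j) (col-cong x≗y zero))
                                 (cong (c *_) (cong₂ _-_ (x≗y (zero , j)) (x≗y (zero , zero))))

    rowDiff-cong : ∀ c i → rowDiff c x i ≡ rowDiff c y i
    rowDiff-cong c i = cong₂ _-_ (cong₂ _-_ (row-cong x≗y i) (row-cong x≗y zero))
                                 (cong (c *_) (cong₂ _-_ (x≗y (i , zero)) (x≗y (zero , zero))))

  private
    additive : ∀ c a a′ b b′ e e′ f f′ →
      a + a′ - (b + b′) - c * (e + e′ - (f + f′)) ≡ a - b - c * (e - f) + (a′ - b′ - c * (e′ - f′))
    additive = solve-∀

  mixedDiff-+ : ∀ x y i j → mixedDiff (x +ᵥ y) i j ≡ mixedDiff x i j + mixedDiff y i j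
  mixedDiff-+ x y i j =
    additive′ (x (i , j)) (y (i , j)) (x (i , zero)) (y (i , zero)) (x (zero , j)) (y (zero , j)) (x (zero , zero)) (y (zero , zero))
    where additive′ : ∀ a a′ b b′ c c′ d d′ → a + a′ - (b + b′) - (c + c′) + (d + d′) ≡ a - b - c + d + (a′ - b′ - c′ + d′)
          additive′ = solve-∀

  colDiff-+ : ∀ c x y j → colDiff c (x +ᵥ y) j ≡ colDiff c x j + colDiff c y j
  colDiff-+ c x y j =
    trans (cong₂ (λ a b → a - b - c * (x (zero , j) + y (zero , j) - (x (zero , zero) + y (zero , zero))))
                 (col-+ x y j) (col-+ x y zero))
          (additive c (col x j) (col y j) (col x zero) (col y zero) (x (zero , j)) (y (zero , j)) (x (zero , zero)) (y (zero , zero)))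

  rowDiff-+ : ∀ c x y i → rowDiff c (x +ᵥ y) i ≡ rowDiff c x i + rowDiff c y i
  rowDiff-+ c x y i =
    trans (cong₂ (λ a b → a - b - c * (x (i , zero) + y (i , zero) - (x (zero , zero) + y (zero , zero))))
                 (row-+ x y i) (row-+ x y zero))
          (additive c (row x i) (row y i) (row x zero) (row y zero) (x (i , zero)) (y (i , zero)) (x (zero , zero)) (y (zero , zero)))

  -- The row, column and total sums cancel in a mixed difference.
  mixedDiff-rookOp : ∀ α β γ z i j → mixedDiff (rookOp α β γ z) i j ≡ α * mixedDiff z i j
  mixedDiff-rookOp α β γ z i j =
    cancel α β γ (z (i , j)) (z (i , zero)) (z (zero , j)) (z (zero , zero)) (row z i) (row z zero) (col z j) (col z zero) (tot z)
    where cancel : ∀ α β γ a b c d ri r0 cj c0 s →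
            α * a + β * (ri + cj) + γ * s - (α * b + β * (ri + c0) + γ * s)
              - (α * c + β * (r0 + cj) + γ * s) + (α * d + β * (r0 + c0) + γ * s)
            ≡ α * (a - b - c + d)
          cancel = solve-∀

  colDiff-rookOp : ∀ c α β γ z j →
    colDiff c (rookOp α β γ z) j ≡ (α + β * N - c * β) * (col z j - col z zero) - c * α * (z (zero , j) - z (zero , zero))
  colDiff-rookOp c α β γ z j =
    trans (cong₂ (λ a b → a - b - c * (rookOp α β γ z (zero , j) - rookOp α β γ z (zero , zero)))
                 (col-rookOp α β γ z j) (col-rookOp α β γ z zero))
          (collect c α β γ N (col z j) (col z zero) (row z zero) (tot z) (z (zero , j)) (z (zero , zero)))
    where collect : ∀ c α β γ N cj c0 r0 s a b →
            (α + β * N) * cj + (β + γ * N) * s - ((α + β * N) * c0 + (β + γ * N) * s)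
              - c * (α * a + β * (r0 + cj) + γ * s - (α * b + β * (r0 + c0) + γ * s))
            ≡ (α + β * N - c * β) * (cj - c0) - c * α * (a - b)
          collect = solve-∀

  rowDiff-rookOp : ∀ c α β γ z i →
    rowDiff c (rookOp α β γ z) i ≡ (α + β * N - c * β) * (row z i - row z zero) - c * α * (z (i , zero) - z (zero , zero))
  rowDiff-rookOp c α β γ z i =
    trans (cong₂ (λ a b → a - b - c * (rookOp α β γ z (i , zero) - rookOp α β γ z (zero , zero)))
                 (row-rookOp α β γ z i) (row-rookOp α β γ z zero))
          (collect c α β γ N (row z i) (row z zero) (col z zero) (tot z) (z (i , zero)) (z (zero , zero)))
    where collect : ∀ c α β γ N ri r0 c0 s a b →
            (α + β * N) * ri + (β + γ * N) * s - ((α + β * N) * r0 + (β + γ * N) * s)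
              - c * (α * a + β * (ri + c0) + γ * s - (α * b + β * (r0 + c0) + γ * s))
            ≡ (α + β * N - c * β) * (ri - r0) - c * α * (a - b)
          collect = solve-∀

  mixedDiff-zeroˡ : ∀ x j → mixedDiff x zero j ≡ 0ℤ
  mixedDiff-zeroˡ x j = cancel (x (zero , j)) (x (zero , zero))
    where cancel : ∀ a b → a - b - a + b ≡ 0ℤ
          cancel = solve-∀

  mixedDiff-zeroʳ : ∀ x i → mixedDiff x i zero ≡ 0ℤ
  mixedDiff-zeroʳ x i = cancel (x (i , zero)) (x (zero , zero))
    where cancel : ∀ a b → a - a - b + b ≡ 0ℤ
          cancel = solve-∀

  colDiff-zero : ∀ c x → colDiff c x zero ≡ 0ℤ
  colDiff-zero c x = cancel c (col x zero) (x (zero , zero))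
    where cancel : ∀ c a b → a - a - c * (b - b) ≡ 0ℤ
          cancel = solve-∀

  rowDiff-zero : ∀ c x → rowDiff c x zero ≡ 0ℤ
  rowDiff-zero c x = cancel c (row x zero) (x (zero , zero))
    where cancel : ∀ c a b → a - a - c * (b - b) ≡ 0ℤ
          cancel = solve-∀

  sum-colDiff : ∀ c x → sumFin (colDiff c x) ≡ tot x - N * col x zero - c * (row x zero - N * x (zero , zero))
  sum-colDiff c x =
    trans (sumFin-- (λ j → col x j - col x zero) (λ j → c * (x (zero , j) - x (zero , zero))))
          (cong₂ _-_ (trans (sumFin-- (col x) (λ _ → col x zero))
                            (cong₂ _-_ (sym (tot≡sum-col x)) (sumFin-const {n} (col x zero))))
                     (trans (sumFin-*ˡ c (λ j → x (zero , j) - x (zero , zero)))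
                            (cong (c *_) (trans (sumFin-- (λ j → x (zero , j)) (λ _ → x (zero , zero)))
                                                (cong (row x zero -_) (sumFin-const {n} (x (zero , zero))))))))

  sum-rowDiff : ∀ c x → sumFin (rowDiff c x) ≡ tot x - N * row x zero - c * (col x zero - N * x (zero , zero))
  sum-rowDiff c x =
    trans (sumFin-- (λ i → row x i - row x zero) (λ i → c * (x (i , zero) - x (zero , zero))))
          (cong₂ _-_ (trans (sumFin-- (row x) (λ _ → row x zero))
                            (cong (tot x -_) (sumFin-const {n} (row x zero))))
                     (trans (sumFin-*ˡ c (λ i → x (i , zero) - x (zero , zero)))
                            (cong (c *_) (trans (sumFin-- (λ i → x (i , zero)) (λ _ → x (zero , zero)))
                                                (cong (col x zero -_) (sumFin-const {n} (x (zero , zero))))))))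

  private
    shift : ∀ N c a b u → a - b - N * u ≡ a - b - c * u + (c - N) * u
    shift = solve-∀

  sum-mixedDiff-col : ∀ c x j →
    sumFin (λ i → mixedDiff x i j) ≡ colDiff c x j + (c - N) * (x (zero , j) - x (zero , zero))
  sum-mixedDiff-col c x j =
    trans (sumFin-+ (λ i → x (i , j) - x (i , zero) - x (zero , j)) (λ _ → x (zero , zero)))
          (trans (cong₂ _+_ (trans (sumFin-- (λ i → x (i , j) - x (i , zero)) (λ _ → x (zero , j)))
                                   (cong₂ _-_ (sumFin-- (λ i → x (i , j)) (λ i → x (i , zero)))
                                              (sumFin-const {n} (x (zero , j)))))
                            (sumFin-const {n} (x (zero , zero))))
                 (trans (factor (col x j) (col x zero) N (x (zero , j)) (x (zero , zero)))
                        (shift N c (col x j) (col x zero) (x (zero , j) - x (zero , zero)))))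
    where factor : ∀ a b N c d → a - b - N * c + N * d ≡ a - b - N * (c - d)
          factor = solve-∀

  sum-mixedDiff-row : ∀ c x i →
    sumFin (λ j → mixedDiff x i j) ≡ rowDiff c x i + (c - N) * (x (i , zero) - x (zero , zero))
  sum-mixedDiff-row c x i =
    trans (sumFin-+ (λ j → x (i , j) - x (i , zero) - x (zero , j)) (λ _ → x (zero , zero)))
          (trans (cong₂ _+_ (trans (sumFin-- (λ j → x (i , j) - x (i , zero)) (λ j → x (zero , j)))
                                   (cong (_- row x zero) (sumFin-- (λ j → x (i , j)) (λ _ → x (i , zero)))))
                            (sumFin-const {n} (x (zero , zero))))
                 (trans (cong (λ t → row x i - t - row x zero + N * x (zero , zero)) (sumFin-const {n} (x (i , zero))))
                        (trans (factor (row x i) (row x zero) N (x (i , zero)) (x (zero , zero)))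
                               (shift N c (row x i) (row x zero) (x (i , zero) - x (zero , zero))))))
    where factor : ∀ a b N c d → a - N * c - b + N * d ≡ a - b - N * (c - d)
          factor = solve-∀

  ∣-missing-term : ∀ {D} (g : Fin n → ℤ) → D ∣ g zero → (∀ p → D ∣ g (inner p)) → D ∣ sumFin g → D ∣ g (suc zero)
  ∣-missing-term g D∣g₀ D∣gᵢ D∣Σg =
    ∣-respʳ (cancel (g zero) (g (suc zero)) (sumFin (λ p → g (inner p))))
            (∣m∣n⇒∣m-n (∣m∣n⇒∣m-n D∣Σg D∣g₀) (sumFin-∣ (λ p → g (inner p)) D∣gᵢ))
    where cancel : ∀ a b c → a + (b + c) - a - c ≡ b
          cancel = solve-∀

  ∣-from-sum : ∀ {D} (g : Fin n → ℤ) → D ∣ g zero → (∀ p → D ∣ g (inner p)) → D ∣ sumFin g → ∀ i → D ∣ g i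
  ∣-from-sum g D∣g₀ D∣gᵢ D∣Σg zero          = D∣g₀
  ∣-from-sum g D∣g₀ D∣gᵢ D∣Σg (suc zero)    = ∣-missing-term g D∣g₀ D∣gᵢ D∣Σg
  ∣-from-sum g D∣g₀ D∣gᵢ D∣Σg (suc (suc p)) = D∣gᵢ p

  -- The missing mixed differences in row 1 and column 1 are recovered from row and column sums.
  mixedDiff-∣ : ∀ {T} c x → T ∣ c - N →
    (∀ p q → T ∣ mixedDiff x (inner p) (inner q)) →
    (∀ j → T ∣ colDiff c x j) → (∀ p → T ∣ rowDiff c x (inner p)) →
    ∀ i j → T ∣ mixedDiff x i j
  mixedDiff-∣ {T} c x T∣c-N T∣inner T∣colDiff T∣rowDiff = go
    where
      T∣₀ⱼ : ∀ j → T ∣ mixedDiff x zero j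
      T∣₀ⱼ j = ∣-respʳ (sym (mixedDiff-zeroˡ x j)) ∣0
      T∣ᵢ₀ : ∀ i → T ∣ mixedDiff x i zero
      T∣ᵢ₀ i = ∣-respʳ (sym (mixedDiff-zeroʳ x i)) ∣0
      T∣col-sum : ∀ j → T ∣ sumFin (λ i → mixedDiff x i j)
      T∣col-sum j = ∣-respʳ (sym (sum-mixedDiff-col c x j)) (∣m∣n⇒∣m+n (T∣colDiff j) (∣m⇒∣m*n _ T∣c-N))
      T∣row-sum : ∀ p → T ∣ sumFin (λ j → mixedDiff x (inner p) j)
      T∣row-sum p = ∣-respʳ (sym (sum-mixedDiff-row c x (inner p))) (∣m∣n⇒∣m+n (T∣rowDiff p) (∣m⇒∣m*n _ T∣c-N))
      T∣₁ᵢ : ∀ q → T ∣ mixedDiff x (suc zero) (inner q)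
      T∣₁ᵢ q = ∣-missing-term (λ i → mixedDiff x i (inner q)) (T∣₀ⱼ _) (λ p → T∣inner p q) (T∣col-sum (inner q))
      T∣ᵢ₁ : ∀ p → T ∣ mixedDiff x (inner p) (suc zero)
      T∣ᵢ₁ p = ∣-missing-term (mixedDiff x (inner p)) (T∣ᵢ₀ _) (T∣inner p) (T∣row-sum p)
      go : ∀ i j → T ∣ mixedDiff x i j
      go zero j = T∣₀ⱼ j
      go (suc i) zero = T∣ᵢ₀ (suc i)
      go (suc zero) (suc zero) = ∣-missing-term (λ i → mixedDiff x i (suc zero)) (T∣₀ⱼ _) T∣ᵢ₁ (T∣col-sum (suc zero))
      go (suc zero) (suc (suc q)) = T∣₁ᵢ q
      go (suc (suc p)) (suc zero) = T∣ᵢ₁ p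
      go (suc (suc p)) (suc (suc q)) = T∣inner p q

  module Template (a b e : ℤ) (f g : Fin (suc k) → ℤ) (U : Fin (suc k) → Fin (suc k) → ℤ) where

    template : Vec n
    template (zero , zero)               = 0ℤ
    template (zero , suc zero)           = a
    template (zero , suc (suc q))        = 0ℤ
    template (suc zero , zero)           = b
    template (suc (suc p) , zero)        = 0ℤ
    template (suc zero , suc zero)       = e
    template (suc zero , suc (suc q))    = f q
    template (suc (suc p) , suc zero)    = g p
    template (suc (suc p) , suc (suc q)) = U p q

    ΣUʳ ΣUᶜ : Fin (suc k) → ℤ
    ΣUʳ p = sumFin (U p)
    ΣUᶜ q = sumFin (λ p → U p q)

    Σf Σg ΣU : ℤ
    Σf = sumFin f
    Σg = sumFin g
    ΣU = sumFin ΣUʳ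

    sum-ΣUᶜ : sumFin ΣUᶜ ≡ ΣU
    sum-ΣUᶜ = sym (sumFin-swap U)

    row-zero : row template zero ≡ a
    row-zero = trans (ℤP.+-identityˡ _) (trans (cong (_+_ a) (sumFin-zero {suc k})) (ℤP.+-identityʳ a))

    row-inner : ∀ p → row template (inner p) ≡ g p + ΣUʳ p
    row-inner p = ℤP.+-identityˡ _

    col-zero : col template zero ≡ b
    col-zero = trans (ℤP.+-identityˡ _) (trans (cong (_+_ b) (sumFin-zero {suc k})) (ℤP.+-identityʳ b))

    col-inner : ∀ q → col template (inner q) ≡ f q + ΣUᶜ q
    col-inner q = ℤP.+-identityˡ _

    tot-template : tot template ≡ a + (b + (e + Σf) + (Σg + ΣU))
    tot-template = cong₂ _+_ row-zero (cong (_+_ (b + (e + Σf))) (trans (sumFin-cong row-inner) (sumFin-+ g ΣUʳ)))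

module SmithComplement (k : ℕ) where

  open import Defs
  open FinSum
  open IntDivisibility
  open DirectSum
  open import Data.Nat using (_∸_; _^_)
  import Data.Nat as ℕ
  import Data.Nat.Properties as ℕP
  open import Data.Integer using (ℤ; +_; _-_; _*_; _+_; 0ℤ; 1ℤ; -_)
  import Data.Integer.Properties as ℤP
  open import Data.Integer.Divisibility.Signed
    using (_∣_; divides; ∣-refl; ∣m∣n⇒∣m+n; ∣m∣n⇒∣m-n; ∣m⇒∣m*n; *-monoʳ-∣)
  open import Data.Fin using (Fin; zero; suc)
  open import Data.Fin.Properties using (+↔⊎)
  open import Data.List using (replicate; _++_; [_])
  open import Data.Sum using (_⊎_; inj₁; inj₂; [_,_]′)
  open import Data.Product using (_,_)
  open import Data.Unit using (⊤; tt)
  open import Function using (const)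
  open import Function.Properties.Inverse using (↔-trans)
  open import Relation.Binary.PropositionalEquality using (_≡_; sym; trans; cong; cong₂)
  open import Data.Integer.Tactic.RingSolver using (solve-∀)

  m n : ℕ
  m = suc (suc k)
  n = suc m

  open RookOperator {n}
  open Image {n}

  M : ℤ
  M = + m

  I : Set
  I = (Fin m ⊎ Fin m) ⊎ ⊤

  d : I → ℕ
  d = [ const m , const (m ^ 2) ]′

  enum : Enumerates d (replicate (2 ℕ.* (n ∸ 1)) (n ∸ 1) ++ [ (n ∸ 1) ^ 2 ])
  enum = enumerates-++ (enumerates-replicate (2 ℕ.* (n ∸ 1)) m (↔-trans (Fin-cast↔ (cong (m ℕ.+_) (ℕP.+-identityʳ m))) +↔⊎))
                       enumerates-[ m ^ 2 ]

  m^2≡M*M : + (m ^ 2) ≡ M * M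
  m^2≡M*M = trans (ℤP.pos-* m (m ℕ.* 1)) (cong (M *_) (cong +_ (ℕP.*-identityʳ m)))

  φ : I → Vec n → ℤ
  φ (inj₁ (inj₁ p)) x = col x (suc p) - col x zero
  φ (inj₁ (inj₂ p)) x = row x (suc p) - row x zero
  φ (inj₂ _)        x = tot x - M * (row x zero + col x zero)

  φ-cong : ∀ q {x y : Vec n} → (∀ v → x v ≡ y v) → φ q x ≡ φ q y
  φ-cong (inj₁ (inj₁ p)) x≗y = cong₂ _-_ (col-cong x≗y (suc p)) (col-cong x≗y zero)
  φ-cong (inj₁ (inj₂ p)) x≗y = cong₂ _-_ (row-cong x≗y (suc p)) (row-cong x≗y zero)
  φ-cong (inj₂ _)        x≗y = cong₂ _-_ (tot-cong x≗y) (cong (M *_) (cong₂ _+_ (row-cong x≗y zero) (col-cong x≗y zero)))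

  φ-+ : ∀ q x y → φ q (x +ᵥ y) ≡ φ q x + φ q y
  φ-+ (inj₁ (inj₁ p)) x y =
    trans (cong₂ _-_ (col-+ x y (suc p)) (col-+ x y zero)) (interchange (col x (suc p)) (col y (suc p)) (col x zero) (col y zero))
    where interchange : ∀ a b c d → a + b - (c + d) ≡ a - c + (b - d)
          interchange = solve-∀
  φ-+ (inj₁ (inj₂ p)) x y =
    trans (cong₂ _-_ (row-+ x y (suc p)) (row-+ x y zero)) (interchange (row x (suc p)) (row y (suc p)) (row x zero) (row y zero))
    where interchange : ∀ a b c d → a + b - (c + d) ≡ a - c + (b - d)
          interchange = solve-∀
  φ-+ (inj₂ _) x y =
    trans (cong₂ _-_ (tot-+ x y) (cong (M *_) (cong₂ _+_ (row-+ x y zero) (col-+ x y zero))))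
          (interchange M (tot x) (tot y) (row x zero) (row y zero) (col x zero) (col y zero))
    where interchange : ∀ M a b c d e f → a + b - M * (c + d + (e + f)) ≡ a - M * (c + e) + (b - M * (d + f))
          interchange = solve-∀

  private
    difference : ∀ M a b s → (1ℤ + (- 1ℤ) * (1ℤ + M)) * a + ((- 1ℤ) + 1ℤ * (1ℤ + M)) * s
                             - ((1ℤ + (- 1ℤ) * (1ℤ + M)) * b + ((- 1ℤ) + 1ℤ * (1ℤ + M)) * s) ≡ (b - a) * M
    difference = solve-∀

  φ-rookOp : ∀ q z → + d q ∣ φ q (rookOp 1ℤ (- 1ℤ) 1ℤ z)
  φ-rookOp (inj₁ (inj₁ p)) z =
    divides (col z zero - col z (suc p))
            (trans (cong₂ _-_ (col-rookOp 1ℤ (- 1ℤ) 1ℤ z (suc p)) (col-rookOp 1ℤ (- 1ℤ) 1ℤ z zero))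
                   (difference M (col z (suc p)) (col z zero) (tot z)))
  φ-rookOp (inj₁ (inj₂ p)) z =
    divides (row z zero - row z (suc p))
            (trans (cong₂ _-_ (row-rookOp 1ℤ (- 1ℤ) 1ℤ z (suc p)) (row-rookOp 1ℤ (- 1ℤ) 1ℤ z zero))
                   (difference M (row z (suc p)) (row z zero) (tot z)))
  φ-rookOp (inj₂ _) z =
    divides′ m^2≡M*M (row z zero + col z zero - tot z)
      (trans (cong₂ _-_ (tot-rookOp 1ℤ (- 1ℤ) 1ℤ z)
                        (cong (M *_) (cong₂ _+_ (row-rookOp 1ℤ (- 1ℤ) 1ℤ z zero) (col-rookOp 1ℤ (- 1ℤ) 1ℤ z zero))))
             (collect M (row z zero) (col z zero) (tot z)))
    where collect : ∀ M a b s →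
            (1ℤ + (- 1ℤ) * (1ℤ + M) + (- 1ℤ) * (1ℤ + M) + 1ℤ * (1ℤ + M) * (1ℤ + M)) * s
              - M * ((1ℤ + (- 1ℤ) * (1ℤ + M)) * a + ((- 1ℤ) + 1ℤ * (1ℤ + M)) * s
                     + ((1ℤ + (- 1ℤ) * (1ℤ + M)) * b + ((- 1ℤ) + 1ℤ * (1ℤ + M)) * s))
            ≡ (a + b - s) * (M * M)
          collect = solve-∀

  inverse : ∀ x v → rookOp 1ℤ (- 1ℤ) 1ℤ (rookOp (M * M) (- M) 1ℤ x) v ≡ x v * (M * M)
  inverse x (i , j) = trans (rookOp-∘ 1ℤ (- 1ℤ) 1ℤ (M * M) (- M) 1ℤ x i j) (collect M (x (i , j)) (row x i + col x j) (tot x))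
    where collect : ∀ M X RC S →
            1ℤ * (M * M) * X + (1ℤ * (- M) + (- 1ℤ) * (M * M + (- M) * (1ℤ + M))) * RC
              + (1ℤ * 1ℤ + ((- 1ℤ) + (- 1ℤ)) * ((- M) + 1ℤ * (1ℤ + M))
                 + 1ℤ * (M * M + (- M) * (1ℤ + M) + (- M) * (1ℤ + M) + 1ℤ * (1ℤ + M) * (1ℤ + M))) * S
            ≡ X * (M * M)
          collect = solve-∀

  φ-kernel : ∀ x → (∀ q → + d q ∣ φ q x) → InIm (rookCompAdj n) x
  φ-kernel x d∣φ = ∈-image-by-division (rookCompAdj n) 1ℤ (- 1ℤ) 1ℤ apply-rookCompAdj x (rookOp (M * M) (- M) 1ℤ x) (inverse x) M*M∣ψ
    where
      M∣row : ∀ i → M ∣ row x i - row x zero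
      M∣row zero    = ∣-respʳ (sym (ℤP.+-inverseʳ (row x zero))) ∣0
      M∣row (suc p) = d∣φ (inj₁ (inj₂ p))
      M∣col : ∀ j → M ∣ col x j - col x zero
      M∣col zero    = ∣-respʳ (sym (ℤP.+-inverseʳ (col x zero))) ∣0
      M∣col (suc p) = d∣φ (inj₁ (inj₁ p))
      M*M∣ψ : ∀ v → M * M ∣ rookOp (M * M) (- M) 1ℤ x v
      M*M∣ψ (i , j) =
        ∣-respʳ (sym (regroup M (x (i , j)) (row x i) (col x j) (row x zero) (col x zero) (tot x)))
          (∣m∣n⇒∣m-n (∣m∣n⇒∣m+n (∣m⇒∣m*n (x (i , j)) ∣-refl) (∣-respˡ m^2≡M*M (d∣φ (inj₂ tt))))
                     (*-monoʳ-∣ M (∣m∣n⇒∣m+n (M∣row i) (M∣col j))))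
        where
          regroup : ∀ M X R C R0 C0 S → M * M * X + (- M) * (R + C) + 1ℤ * S ≡
                      M * M * X + (S - M * (R0 + C0)) - M * ((R - R0) + (C - C0))
          regroup = solve-∀

  module Preimage (z : I → ℤ) where

    colTarget rowTarget : Fin m → ℤ
    colTarget p = z (inj₁ (inj₁ p))
    rowTarget p = z (inj₁ (inj₂ p))

    Σcol : ℤ
    Σcol = sumFin colTarget

    v : Fin m → ℤ
    v p = rowTarget p + Σcol

    Σv : ℤ
    Σv = sumFin v

    u : Fin m → ℤ
    u p = colTarget p + Σv

    Σu : ℤ
    Σu = sumFin u

    t : ℤ
    t = z (inj₂ tt) + (M - 1ℤ) * (Σu + Σv)

    preimage : Vec n
    preimage (zero , zero)   = t
    preimage (zero , suc l)  = t + u l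
    preimage (suc a , zero)  = t + v a
    preimage (suc a , suc l) = t

    Σu≡ : Σu ≡ Σcol + M * Σv
    Σu≡ = trans (sumFin-+ colTarget (λ _ → Σv)) (cong (_+_ Σcol) (sumFin-const {m} Σv))

    row-zero : row preimage zero ≡ t + (M * t + Σu)
    row-zero = cong (_+_ t) (trans (sumFin-+ (λ _ → t) u) (cong (_+ Σu) (sumFin-const {m} t)))

    row-suc : ∀ p → row preimage (suc p) ≡ t + v p + M * t
    row-suc p = cong (_+_ (t + v p)) (sumFin-const {m} t)

    col-zero : col preimage zero ≡ t + (M * t + Σv)
    col-zero = cong (_+_ t) (trans (sumFin-+ (λ _ → t) v) (cong (_+ Σv) (sumFin-const {m} t)))

    col-suc : ∀ p → col preimage (suc p) ≡ t + u p + M * t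
    col-suc p = cong (_+_ (t + u p)) (sumFin-const {m} t)

    tot-preimage : tot preimage ≡ t + (M * t + Σu) + ((M * t + Σv) + M * (M * t))
    tot-preimage =
      cong₂ _+_ row-zero
        (trans (sumFin-cong row-suc)
               (trans (sumFin-+ (λ p → t + v p) (λ _ → M * t))
                      (cong₂ _+_ (trans (sumFin-+ (λ _ → t) v) (cong (_+ Σv) (sumFin-const {m} t)))
                                 (sumFin-const {m} (M * t)))))

    φ-preimage : ∀ q → + d q ∣ φ q preimage - z q
    φ-preimage (inj₁ (inj₁ p)) =
      divides 0ℤ (trans (cong₂ (λ a b → a - b - colTarget p) (col-suc p) col-zero) (cancel t (colTarget p) Σv M))
      where cancel : ∀ t Y S M → t + (Y + S) + M * t - (t + (M * t + S)) - Y ≡ 0ℤ * M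
            cancel = solve-∀
    φ-preimage (inj₁ (inj₂ p)) =
      divides (- Σv) (trans (cong₂ (λ a b → a - b - rowTarget p) (row-suc p) (trans row-zero (cong (λ w → t + (M * t + w)) Σu≡)))
                            (cancel t (rowTarget p) Σcol Σv M))
      where cancel : ∀ t Z SY S M → t + (Z + SY) + M * t - (t + (M * t + (SY + M * S))) - Z ≡ (- S) * M
            cancel = solve-∀
    φ-preimage (inj₂ _) =
      divides′ m^2≡M*M (- t)
        (trans (cong₂ (λ a b → a - M * b - z (inj₂ tt)) tot-preimage (cong₂ _+_ row-zero col-zero))
               (cancel (z (inj₂ tt)) Σu Σv M))
      where cancel : ∀ E Su Sv M → let t = E + (M - 1ℤ) * (Su + Sv) in
              t + (M * t + Su) + ((M * t + Sv) + M * (M * t)) - M * (t + (M * t + Su) + (t + (M * t + Sv))) - E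
              ≡ (- t) * (M * M)
            cancel = solve-∀

  smithGroup : SmithGroupIso (rookCompAdj n) (replicate (2 ℕ.* (n ∸ 1)) (n ∸ 1) ++ [ (n ∸ 1) ^ 2 ])
  smithGroup = FromInvariants.isoDirectSum (rookCompAdj n) (const ⊤) d enum φ φ-cong φ-+
    (λ q z → ∣-respʳ (sym (φ-cong q (apply-rookCompAdj z))) (φ-rookOp q z))
    (λ {x} {y} _ _ → φ-kernel (x -ᵥ y))
    (λ z → Preimage.preimage z , tt , Preimage.φ-preimage z)

module SmithRook (k : ℕ) where

  open import Defs
  open FinSum
  open IntDivisibility
  open DirectSum
  open Differences k
  open import Data.Nat using (_∸_; _^_)
  import Data.Nat as ℕ
  import Data.Nat.Properties as ℕP
  open import Data.Integer using (ℤ; +_; _-_; _*_; _+_; 0ℤ; 1ℤ; -_)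
  import Data.Integer.Properties as ℤP
  open import Data.Integer.Divisibility.Signed using (_∣_; divides; ∣-trans; ∣m∣n⇒∣m+n; ∣m⇒∣-m)
  open import Data.Fin using (Fin; zero; suc)
  open import Data.Fin.Properties using (+↔⊎; *↔×)
  open import Data.List using (replicate; _++_; [_])
  open import Data.Sum using (_⊎_; inj₁; inj₂; [_,_]′)
  open import Data.Product using (_×_; _,_)
  open import Data.Unit using (⊤; tt)
  open import Function using (const)
  open import Function.Properties.Inverse using (↔-trans)
  open import Relation.Binary.PropositionalEquality using (_≡_; sym; trans; cong; cong₂)
  open import Data.Integer.Tactic.RingSolver using (solve-∀)
  import Data.Nat.Tactic.RingSolver as ℕ-Solver

  open RookOperator {n}
  open Image {n}

  m₁ m₂ : ℕ
  m₁ = suc (suc k)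
  m₂ = suc k

  M₁ M₂ : ℤ
  M₁ = + m₁
  M₂ = + m₂

  I : Set
  I = (Fin m₂ × Fin m₂) ⊎ ((Fin m₁ ⊎ Fin m₂) ⊎ ⊤)

  d : I → ℕ
  d = [ const 2 , [ const (2 ℕ.* m₂) , const (2 ℕ.* m₁ ℕ.* m₂) ]′ ]′

  enum : Enumerates d (replicate ((n ∸ 2) ^ 2) 2 ++ replicate (2 ℕ.* n ∸ 3) (2 ℕ.* (n ∸ 2)) ++ [ 2 ℕ.* (n ∸ 1) ℕ.* (n ∸ 2) ])
  enum = enumerates-++ (enumerates-replicate ((n ∸ 2) ^ 2) 2 (↔-trans (Fin-cast↔ (cong (m₂ ℕ.*_) (ℕP.*-identityʳ m₂))) *↔×))
           (enumerates-++ (enumerates-replicate (2 ℕ.* n ∸ 3) (2 ℕ.* m₂) (↔-trans (Fin-cast↔ (2n-3≡m₁+m₂ k)) +↔⊎))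
                          enumerates-[ 2 ℕ.* m₁ ℕ.* m₂ ])
    where 2n-3≡m₁+m₂ : ∀ k → k ℕ.+ suc (suc (suc (k ℕ.+ 0))) ≡ suc (suc k) ℕ.+ suc k
          2n-3≡m₁+m₂ = ℕ-Solver.solve-∀

  2m₂≡ : + (2 ℕ.* m₂) ≡ + 2 * M₂
  2m₂≡ = ℤP.pos-* 2 m₂

  2m₁m₂≡ : + (2 ℕ.* m₁ ℕ.* m₂) ≡ + 2 * M₁ * M₂
  2m₁m₂≡ = trans (ℤP.pos-* (2 ℕ.* m₁) m₂) (cong (_* M₂) (ℤP.pos-* 2 m₁))

  totInvariant : Vec n → ℤ
  totInvariant x = tot x - M₁ * (row x zero + col x zero) + M₁ * M₂ * x (zero , zero)

  φ : I → Vec n → ℤ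
  φ (inj₁ (p , q))             x = mixedDiff x (inner p) (inner q)
  φ (inj₂ (inj₁ (inj₁ l)))     x = colDiff M₂ x (suc l)
  φ (inj₂ (inj₁ (inj₂ p)))     x = rowDiff M₂ x (inner p)
  φ (inj₂ (inj₂ _))            x = totInvariant x

  φ-cong : ∀ q {x y : Vec n} → (∀ v → x v ≡ y v) → φ q x ≡ φ q y
  φ-cong (inj₁ (p , q))         x≗y = mixedDiff-cong x≗y (inner p) (inner q)
  φ-cong (inj₂ (inj₁ (inj₁ l))) x≗y = colDiff-cong x≗y M₂ (suc l)
  φ-cong (inj₂ (inj₁ (inj₂ p))) x≗y = rowDiff-cong x≗y M₂ (inner p)
  φ-cong (inj₂ (inj₂ _))        x≗y =
    cong₂ _+_ (cong₂ _-_ (tot-cong x≗y) (cong (M₁ *_) (cong₂ _+_ (row-cong x≗y zero) (col-cong x≗y zero))))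
              (cong (M₁ * M₂ *_) (x≗y (zero , zero)))

  φ-+ : ∀ q x y → φ q (x +ᵥ y) ≡ φ q x + φ q y
  φ-+ (inj₁ (p , q))         x y = mixedDiff-+ x y (inner p) (inner q)
  φ-+ (inj₂ (inj₁ (inj₁ l))) x y = colDiff-+ M₂ x y (suc l)
  φ-+ (inj₂ (inj₁ (inj₂ p))) x y = rowDiff-+ M₂ x y (inner p)
  φ-+ (inj₂ (inj₂ _))        x y =
    trans (cong₂ (λ a b → a - M₁ * b + M₁ * M₂ * (x (zero , zero) + y (zero , zero)))
                 (tot-+ x y) (cong₂ _+_ (row-+ x y zero) (col-+ x y zero)))
          (interchange M₁ M₂ (tot x) (tot y) (row x zero) (row y zero) (col x zero) (col y zero) (x (zero , zero)) (y (zero , zero)))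
    where interchange : ∀ A B s s′ a a′ b b′ e e′ →
            s + s′ - A * (a + a′ + (b + b′)) + A * B * (e + e′) ≡ s - A * (a + b) + A * B * e + (s′ - A * (a′ + b′) + A * B * e′)
          interchange = solve-∀

  private
    difference : ∀ M a b c d → ((- + 2) + 1ℤ * (1ℤ + (1ℤ + M)) - M * 1ℤ) * (a - b) - M * (- + 2) * (c - d) ≡ (c - d) * (+ 2 * M)
    difference = solve-∀

  φ-rookOp : ∀ q z → + d q ∣ φ q (rookOp (- + 2) 1ℤ 0ℤ z)
  φ-rookOp (inj₁ (p , q)) z =
    ∣-respʳ (sym (mixedDiff-rookOp (- + 2) 1ℤ 0ℤ z (inner p) (inner q)))
            (divides (- mixedDiff z (inner p) (inner q)) (flip (mixedDiff z (inner p) (inner q))))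
    where flip : ∀ u → (- + 2) * u ≡ (- u) * + 2
          flip = solve-∀
  φ-rookOp (inj₂ (inj₁ (inj₁ l))) z =
    ∣-respʳ (sym (colDiff-rookOp M₂ (- + 2) 1ℤ 0ℤ z (suc l)))
            (divides′ 2m₂≡ (z (zero , suc l) - z (zero , zero))
                      (difference M₂ (col z (suc l)) (col z zero) (z (zero , suc l)) (z (zero , zero))))
  φ-rookOp (inj₂ (inj₁ (inj₂ p))) z =
    ∣-respʳ (sym (rowDiff-rookOp M₂ (- + 2) 1ℤ 0ℤ z (inner p)))
            (divides′ 2m₂≡ (z (inner p , zero) - z (zero , zero))
                      (difference M₂ (row z (inner p)) (row z zero) (z (inner p , zero)) (z (zero , zero))))
  φ-rookOp (inj₂ (inj₂ _)) z =
    divides′ 2m₁m₂≡ (- z (zero , zero))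
      (trans (cong₂ (λ a b → a - M₁ * b + M₁ * M₂ * rookOp (- + 2) 1ℤ 0ℤ z (zero , zero))
                    (tot-rookOp (- + 2) 1ℤ 0ℤ z)
                    (cong₂ _+_ (row-rookOp (- + 2) 1ℤ 0ℤ z zero) (col-rookOp (- + 2) 1ℤ 0ℤ z zero)))
             (collect M₂ (tot z) (row z zero) (col z zero) (z (zero , zero))))
    where collect : ∀ M s a b e → let N = 1ℤ + (1ℤ + M) in
            ((- + 2) + 1ℤ * N + 1ℤ * N + 0ℤ * N * N) * s
              - (1ℤ + M) * ((- + 2 + 1ℤ * N) * a + (1ℤ + 0ℤ * N) * s + ((- + 2 + 1ℤ * N) * b + (1ℤ + 0ℤ * N) * s))
              + (1ℤ + M) * M * ((- + 2) * e + 1ℤ * (a + b) + 0ℤ * s)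
            ≡ (- e) * (+ 2 * (1ℤ + M) * M)
          collect = solve-∀

  D : ℤ
  D = + 2 * M₁ * M₂

  inverse : ∀ x v → rookOp (- + 2) 1ℤ 0ℤ (rookOp (- (M₁ * M₂)) M₁ (- 1ℤ) x) v ≡ x v * D
  inverse x (i , j) =
    trans (rookOp-∘ (- + 2) 1ℤ 0ℤ (- (M₁ * M₂)) M₁ (- 1ℤ) x i j) (collect M₂ (x (i , j)) (row x i + col x j) (tot x))
    where collect : ∀ M X RC S → let N = 1ℤ + (1ℤ + M) in
            (- + 2) * (- ((1ℤ + M) * M)) * X + ((- + 2) * (1ℤ + M) + 1ℤ * (- ((1ℤ + M) * M) + (1ℤ + M) * N)) * RC
              + ((- + 2) * (- 1ℤ) + (1ℤ + 1ℤ) * ((1ℤ + M) + (- 1ℤ) * N)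
                 + 0ℤ * (- ((1ℤ + M) * M) + (1ℤ + M) * N + (1ℤ + M) * N + (- 1ℤ) * N * N)) * S
            ≡ X * (+ 2 * (1ℤ + M) * M)
          collect = solve-∀

  module Kernel (x : Vec n) (d∣φ : ∀ q → + d q ∣ φ q x) where

    2M₂ : ℤ
    2M₂ = + 2 * M₂

    2M₂∣colDiff : ∀ j → 2M₂ ∣ colDiff M₂ x j
    2M₂∣colDiff zero    = ∣-respʳ (sym (colDiff-zero M₂ x)) ∣0
    2M₂∣colDiff (suc l) = ∣-respˡ 2m₂≡ (d∣φ (inj₂ (inj₁ (inj₁ l))))

    2M₂∣rowDiff-inner : ∀ p → 2M₂ ∣ rowDiff M₂ x (inner p)
    2M₂∣rowDiff-inner p = ∣-respˡ 2m₂≡ (d∣φ (inj₂ (inj₁ (inj₂ p))))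

    D∣totInvariant : D ∣ totInvariant x
    D∣totInvariant = ∣-respˡ 2m₁m₂≡ (d∣φ (inj₂ (inj₂ tt)))

    -- The sums of the row and column differences are both determined by totInvariant.
    2M₂∣sum-rowDiff : 2M₂ ∣ sumFin (rowDiff M₂ x)
    2M₂∣sum-rowDiff =
      ∣-map₂ (λ qE qY → qE * M₁ + qE * M₁ - qY + x (zero , zero))
        (λ qE eqE qY eqY → trans (sum-rowDiff M₂ x)
          (trans (regroup M₂ (tot x) (row x zero) (col x zero) (x (zero , zero)))
                 (trans (cong₂ (λ a b → a + a - b + + 2 * M₂ * x (zero , zero))
                               (trans eqE (reassoc qE M₁ M₂)) (trans (sym (sum-colDiff M₂ x)) eqY))
                        (factor M₂ (qE * M₁) qY (x (zero , zero))))))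
        D∣totInvariant (sumFin-∣ (colDiff M₂ x) 2M₂∣colDiff)
      where
        regroup : ∀ M s a b e → let N = 1ℤ + (1ℤ + M) in
          s - N * a - M * (b - N * e) ≡
          (s - (1ℤ + M) * (a + b) + (1ℤ + M) * M * e) + (s - (1ℤ + M) * (a + b) + (1ℤ + M) * M * e)
            - (s - N * b - M * (a - N * e)) + + 2 * M * e
        regroup = solve-∀
        reassoc : ∀ q A B → q * (+ 2 * A * B) ≡ q * A * (+ 2 * B)
        reassoc = solve-∀
        factor : ∀ M qE qY e → qE * (+ 2 * M) + qE * (+ 2 * M) - qY * (+ 2 * M) + + 2 * M * e ≡ (qE + qE - qY + e) * (+ 2 * M)
        factor = solve-∀

    2M₂∣rowDiff : ∀ i → 2M₂ ∣ rowDiff M₂ x i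
    2M₂∣rowDiff = ∣-from-sum (rowDiff M₂ x) (∣-respʳ (sym (rowDiff-zero M₂ x)) ∣0) 2M₂∣rowDiff-inner 2M₂∣sum-rowDiff

    2∣mixedDiff : ∀ i j → + 2 ∣ mixedDiff x i j
    2∣mixedDiff = mixedDiff-∣ M₂ x (divides (- 1ℤ) (two M₂)) (λ p q → d∣φ (inj₁ (p , q)))
      (λ j → ∣-trans 2∣2M₂ (2M₂∣colDiff j)) (λ p → ∣-trans 2∣2M₂ (2M₂∣rowDiff (inner p)))
      where
        two : ∀ M → M - (1ℤ + (1ℤ + M)) ≡ (- 1ℤ) * + 2
        two = solve-∀
        2∣2M₂ : + 2 ∣ 2M₂
        2∣2M₂ = divides M₂ (ℤP.*-comm (+ 2) M₂)

    D∣ψ : ∀ v → D ∣ rookOp (- (M₁ * M₂)) M₁ (- 1ℤ) x v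
    D∣ψ (i , j) =
      ∣-respʳ (sym (regroup M₁ M₂ (x (i , j)) (x (i , zero)) (x (zero , j)) (x (zero , zero))
                            (row x i) (row x zero) (col x j) (col x zero) (tot x)))
        (∣m∣n⇒∣m+n (∣m∣n⇒∣m+n (∣m∣n⇒∣m+n (∣m⇒∣-m D∣totInvariant) (M₁· (2M₂∣rowDiff i))) (M₁· (2M₂∣colDiff j)))
                   (∣-map (λ q → - q) (λ q eq → trans (cong ((- (M₁ * M₂)) *_) eq) (negate q M₁ M₂)) (2∣mixedDiff i j)))
      where
        regroup : ∀ A B X Xi0 X0j X00 ri r0 cj c0 s →
          (- (A * B)) * X + A * (ri + cj) + (- 1ℤ) * s ≡
          - (s - A * (r0 + c0) + A * B * X00) + A * (ri - r0 - B * (Xi0 - X00)) + A * (cj - c0 - B * (X0j - X00))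
            + (- (A * B)) * (X - Xi0 - X0j + X00)
        regroup = solve-∀
        negate : ∀ q A B → (- (A * B)) * (q * + 2) ≡ (- q) * (+ 2 * A * B)
        negate = solve-∀
        M₁· : ∀ {w} → 2M₂ ∣ w → D ∣ M₁ * w
        M₁· = ∣-map (λ q → q) (λ q eq → trans (cong (M₁ *_) eq) (reassoc q M₁ M₂))
          where reassoc : ∀ q A B → A * (q * (+ 2 * B)) ≡ q * (+ 2 * A * B)
                reassoc = solve-∀

    ∈-image : InIm (rookAdj n) x
    ∈-image = ∈-image-by-division (rookAdj n) (- + 2) 1ℤ 0ℤ apply-rookAdj x _ (inverse x) D∣ψ

  module Preimage (z : I → ℤ) where

    U : Fin m₂ → Fin m₂ → ℤ
    U p q = z (inj₁ (p , q))

    colTarget : Fin m₁ → ℤ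
    colTarget l = z (inj₂ (inj₁ (inj₁ l)))

    rowTarget : Fin m₂ → ℤ
    rowTarget p = z (inj₂ (inj₁ (inj₂ p)))

    w : ℤ
    w = z (inj₂ (inj₂ tt)) - sumFin colTarget

    g f : Fin m₂ → ℤ
    g p = rowTarget p - sumFin (U p)
    f q = colTarget (suc q) + w - sumFin (λ p → U p q)

    e : ℤ
    e = colTarget zero + w - sumFin g

    open Template 0ℤ w e f g U public

    Σf≡ : Σf ≡ sumFin (λ q → colTarget (suc q)) + M₂ * w - ΣU
    Σf≡ = trans (sumFin-- (λ q → colTarget (suc q) + w) ΣUᶜ)
                (cong₂ _-_ (trans (sumFin-+ (λ q → colTarget (suc q)) (λ _ → w))
                                  (cong (_+_ (sumFin (λ q → colTarget (suc q)))) (sumFin-const {m₂} w)))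
                           sum-ΣUᶜ)

    φ-template : ∀ q → + d q ∣ φ q template - z q
    φ-template (inj₁ (p , q)) = divides 0ℤ (cancel (U p q) (+ 2))
      where cancel : ∀ u D → u - 0ℤ - 0ℤ + 0ℤ - u ≡ 0ℤ * D
            cancel = solve-∀
    φ-template (inj₂ (inj₁ (inj₁ zero))) =
      divides 0ℤ (trans (cong (λ t → 0ℤ + (e + Σg) - t - M₂ * (0ℤ - 0ℤ) - colTarget zero) col-zero)
                        (cancel (colTarget zero) w Σg M₂ (+ 2 * M₂)))
      where cancel : ∀ y w s M D → 0ℤ + (y + w - s + s) - w - M * (0ℤ - 0ℤ) - y ≡ 0ℤ * D
            cancel = solve-∀
    φ-template (inj₂ (inj₁ (inj₁ (suc q)))) =
      divides 0ℤ (trans (cong₂ (λ a b → a - b - M₂ * (0ℤ - 0ℤ) - colTarget (suc q)) (col-inner q) col-zero)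
                        (cancel (colTarget (suc q)) w (ΣUᶜ q) M₂ (+ 2 * M₂)))
      where cancel : ∀ y w s M D → y + w - s + s - w - M * (0ℤ - 0ℤ) - y ≡ 0ℤ * D
            cancel = solve-∀
    φ-template (inj₂ (inj₁ (inj₂ p))) =
      divides 0ℤ (trans (cong₂ (λ a b → a - b - M₂ * (0ℤ - 0ℤ) - rowTarget p) (row-inner p) row-zero)
                        (cancel (rowTarget p) (ΣUʳ p) M₂ (+ 2 * M₂)))
      where cancel : ∀ y s M D → y - s + s - 0ℤ - M * (0ℤ - 0ℤ) - y ≡ 0ℤ * D
            cancel = solve-∀
    φ-template (inj₂ (inj₂ _)) =
      divides 0ℤ
        (trans (cong₂ (λ a b → a - M₁ * b + M₁ * M₂ * 0ℤ - z (inj₂ (inj₂ tt)))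
                      (trans tot-template (cong (λ t → 0ℤ + (w + (e + t) + (Σg + ΣU))) Σf≡))
                      (cong₂ _+_ row-zero col-zero))
               (cancel M₂ (colTarget zero) (sumFin (λ q → colTarget (suc q))) (z (inj₂ (inj₂ tt))) Σg ΣU (+ 2 * M₁ * M₂)))
      where cancel : ∀ M y0 ys C sg ss D →
              0ℤ + ((C - (y0 + ys)) + ((y0 + (C - (y0 + ys)) - sg) + (ys + M * (C - (y0 + ys)) - ss)) + (sg + ss))
                - (1ℤ + M) * (0ℤ + (C - (y0 + ys))) + (1ℤ + M) * M * 0ℤ - C ≡ 0ℤ * D
            cancel = solve-∀

  smithGroup : SmithGroupIso (rookAdj n)
    (replicate ((n ∸ 2) ^ 2) 2 ++ replicate (2 ℕ.* n ∸ 3) (2 ℕ.* (n ∸ 2)) ++ [ 2 ℕ.* (n ∸ 1) ℕ.* (n ∸ 2) ])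
  smithGroup = FromInvariants.isoDirectSum (rookAdj n) (const ⊤) d enum φ φ-cong φ-+
    (λ q z → ∣-respʳ (sym (φ-cong q (apply-rookAdj z))) (φ-rookOp q z))
    (λ {x} {y} _ _ d∣φ → Kernel.∈-image (x -ᵥ y) d∣φ)
    (λ z → Preimage.template z , tt , Preimage.φ-template z)

module CriticalRook (k : ℕ) where

  open import Defs
  open FinSum
  open IntDivisibility
  open DirectSum
  open Differences k
  open import Data.Nat using (_∸_; _^_)
  import Data.Nat as ℕ
  import Data.Nat.Properties as ℕP
  open import Data.Integer using (ℤ; +_; _-_; _*_; _+_; 0ℤ; 1ℤ; -_)
  import Data.Integer.Properties as ℤP
  open import Data.Integer.Divisibility.Signed using (_∣_; divides; ∣-trans; ∣m∣n⇒∣m+n)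
  open import Data.Fin using (Fin; zero; suc)
  open import Data.Fin.Properties using (+↔⊎; *↔×; 1↔⊤)
  open import Data.List using (replicate; _++_)
  open import Data.Sum using (_⊎_; inj₁; inj₂; [_,_]′)
  open import Data.Sum.Function.Propositional using (_⊎-↔_)
  open import Data.Product using (_×_; _,_)
  open import Data.Unit using (⊤; tt)
  open import Function using (const)
  open import Function.Properties.Inverse using (↔-trans)
  open import Relation.Binary.PropositionalEquality using (_≡_; sym; trans; cong; cong₂)
  open import Data.Integer.Tactic.RingSolver using (solve-∀)

  open RookOperator {n}
  open Image {n}

  m₂ : ℕ
  m₂ = suc k

  L : Mat n
  L = laplacian (rookAdj n)

  I : Set
  I = ((Fin m₂ × Fin m₂) ⊎ ⊤) ⊎ (Fin m₂ ⊎ Fin m₂)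

  d : I → ℕ
  d = [ const (2 ℕ.* n) , const (2 ℕ.* n ^ 2) ]′

  enum : Enumerates d (replicate ((n ∸ 2) ^ 2 ℕ.+ 1) (2 ℕ.* n) ++ replicate (2 ℕ.* (n ∸ 2)) (2 ℕ.* n ^ 2))
  enum = enumerates-++
    (enumerates-replicate ((n ∸ 2) ^ 2 ℕ.+ 1) (2 ℕ.* n)
      (↔-trans +↔⊎ (↔-trans (Fin-cast↔ (cong (m₂ ℕ.*_) (ℕP.*-identityʳ m₂))) *↔× ⊎-↔ 1↔⊤)))
    (enumerates-replicate (2 ℕ.* (n ∸ 2)) (2 ℕ.* n ^ 2)
      (↔-trans (Fin-cast↔ (cong (m₂ ℕ.+_) (ℕP.+-identityʳ m₂))) +↔⊎))

  2n≡ : + (2 ℕ.* n) ≡ + 2 * N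
  2n≡ = ℤP.pos-* 2 n

  2n²≡ : + (2 ℕ.* n ^ 2) ≡ + 2 * N * N
  2n²≡ = trans (ℤP.pos-* 2 (n ^ 2))
               (trans (cong (+ 2 *_) (trans (ℤP.pos-* n (n ℕ.* 1)) (cong (N *_) (cong +_ (ℕP.*-identityʳ n)))))
                      (sym (ℤP.*-assoc (+ 2) N N)))

  rowColInvariant : Vec n → ℤ
  rowColInvariant x = row x zero - col x zero + N * x (zero , zero)

  φ : I → Vec n → ℤ
  φ (inj₁ (inj₁ (p , q))) x = mixedDiff x (inner p) (inner q)
  φ (inj₁ (inj₂ _))       x = rowColInvariant x
  φ (inj₂ (inj₁ q))       x = colDiff (- N) x (inner q)
  φ (inj₂ (inj₂ p))       x = rowDiff (- N) x (inner p)

  φ-cong : ∀ q {x y : Vec n} → (∀ v → x v ≡ y v) → φ q x ≡ φ q y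
  φ-cong (inj₁ (inj₁ (p , q))) x≗y = mixedDiff-cong x≗y (inner p) (inner q)
  φ-cong (inj₁ (inj₂ _))       x≗y =
    cong₂ _+_ (cong₂ _-_ (row-cong x≗y zero) (col-cong x≗y zero)) (cong (N *_) (x≗y (zero , zero)))
  φ-cong (inj₂ (inj₁ q))       x≗y = colDiff-cong x≗y (- N) (inner q)
  φ-cong (inj₂ (inj₂ p))       x≗y = rowDiff-cong x≗y (- N) (inner p)

  φ-+ : ∀ q x y → φ q (x +ᵥ y) ≡ φ q x + φ q y
  φ-+ (inj₁ (inj₁ (p , q))) x y = mixedDiff-+ x y (inner p) (inner q)
  φ-+ (inj₁ (inj₂ _))       x y =
    trans (cong₂ (λ a b → a - b + N * (x (zero , zero) + y (zero , zero))) (row-+ x y zero) (col-+ x y zero))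
          (interchange N (row x zero) (row y zero) (col x zero) (col y zero) (x (zero , zero)) (y (zero , zero)))
    where interchange : ∀ N a a′ b b′ e e′ → a + a′ - (b + b′) + N * (e + e′) ≡ a - b + N * e + (a′ - b′ + N * e′)
          interchange = solve-∀
  φ-+ (inj₂ (inj₁ q))       x y = colDiff-+ (- N) x y (inner q)
  φ-+ (inj₂ (inj₂ p))       x y = rowDiff-+ (- N) x y (inner p)

  private
    difference : ∀ N a b c d → (N + N + (- 1ℤ) * N - (- N) * (- 1ℤ)) * (a - b) - (- N) * (N + N) * (c - d) ≡ (c - d) * (+ 2 * N * N)
    difference = solve-∀

  φ-rookOp : ∀ q z → + d q ∣ φ q (rookOp (N + N) (- 1ℤ) 0ℤ z)
  φ-rookOp (inj₁ (inj₁ (p , q))) z =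
    ∣-respʳ (sym (mixedDiff-rookOp (N + N) (- 1ℤ) 0ℤ z (inner p) (inner q)))
            (divides′ 2n≡ (mixedDiff z (inner p) (inner q)) (double N (mixedDiff z (inner p) (inner q))))
    where double : ∀ N u → (N + N) * u ≡ u * (+ 2 * N)
          double = solve-∀
  φ-rookOp (inj₁ (inj₂ _)) z =
    divides′ 2n≡ (N * z (zero , zero) - col z zero)
      (trans (cong₂ (λ a b → a - b + N * rookOp (N + N) (- 1ℤ) 0ℤ z (zero , zero))
                    (row-rookOp (N + N) (- 1ℤ) 0ℤ z zero) (col-rookOp (N + N) (- 1ℤ) 0ℤ z zero))
             (collect N (row z zero) (col z zero) (tot z) (z (zero , zero))))
    where collect : ∀ N a b s e →
            (N + N + (- 1ℤ) * N) * a + ((- 1ℤ) + 0ℤ * N) * s - ((N + N + (- 1ℤ) * N) * b + ((- 1ℤ) + 0ℤ * N) * s)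
              + N * ((N + N) * e + (- 1ℤ) * (a + b) + 0ℤ * s)
            ≡ (N * e - b) * (+ 2 * N)
          collect = solve-∀
  φ-rookOp (inj₂ (inj₁ q)) z =
    ∣-respʳ (sym (colDiff-rookOp (- N) (N + N) (- 1ℤ) 0ℤ z (inner q)))
            (divides′ 2n²≡ (z (zero , inner q) - z (zero , zero))
                      (difference N (col z (inner q)) (col z zero) (z (zero , inner q)) (z (zero , zero))))
  φ-rookOp (inj₂ (inj₂ p)) z =
    ∣-respʳ (sym (rowDiff-rookOp (- N) (N + N) (- 1ℤ) 0ℤ z (inner p)))
            (divides′ 2n²≡ (z (inner p , zero) - z (zero , zero))
                      (difference N (row z (inner p)) (row z zero) (z (inner p , zero)) (z (zero , zero))))

  D : ℤ
  D = + 2 * N * N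

  onesEigenvalue≡0 : onesEigenvalue (N + N) (- 1ℤ) 0ℤ ≡ 0ℤ
  onesEigenvalue≡0 = cancel N
    where cancel : ∀ N → N + N + (- 1ℤ) * N + (- 1ℤ) * N + 0ℤ * N * N ≡ 0ℤ
          cancel = solve-∀

  inverse : ∀ x → tot x ≡ 0ℤ → ∀ i j → rookOp (N + N) (- 1ℤ) 0ℤ (rookOp N 1ℤ 0ℤ x) (i , j) ≡ x (i , j) * D
  inverse x tot≡0 i j =
    trans (rookOp-∘ (N + N) (- 1ℤ) 0ℤ N 1ℤ 0ℤ x i j)
          (trans (cong (λ s → (N + N) * N * x (i , j) + ((N + N) * 1ℤ + (- 1ℤ) * (N + 1ℤ * N)) * (row x i + col x j)
                              + ((N + N) * 0ℤ + ((- 1ℤ) + (- 1ℤ)) * (1ℤ + 0ℤ * N) + 0ℤ * (N + 1ℤ * N + 1ℤ * N + 0ℤ * N * N)) * s)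
                       tot≡0)
                 (collect N (x (i , j)) (row x i + col x j)))
    where collect : ∀ N X RC →
            (N + N) * N * X + ((N + N) * 1ℤ + (- 1ℤ) * (N + 1ℤ * N)) * RC
              + ((N + N) * 0ℤ + ((- 1ℤ) + (- 1ℤ)) * (1ℤ + 0ℤ * N) + 0ℤ * (N + 1ℤ * N + 1ℤ * N + 0ℤ * N * N)) * 0ℤ
            ≡ X * (+ 2 * N * N)
          collect = solve-∀

  open Laplacian L (N + N) (- 1ℤ) 0ℤ apply-laplacian-rookAdj (zero , zero) onesEigenvalue≡0 N 1ℤ 0ℤ D inverse

  2N : ℤ
  2N = + 2 * N

  module Kernel (x : Vec n) (tot≡0 : tot x ≡ 0ℤ) (d∣φ : ∀ q → + d q ∣ φ q x) where

    2N∣rowColInvariant : 2N ∣ rowColInvariant x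
    2N∣rowColInvariant = ∣-respˡ 2n≡ (d∣φ (inj₁ (inj₂ tt)))

    -- With tot x = 0, the sums of the row and column differences are multiples of rowColInvariant.
    D∣sum-colDiff : D ∣ sumFin (colDiff (- N) x)
    D∣sum-colDiff =
      ∣-map (λ q → q - x (zero , zero))
        (λ q eq → trans (sum-colDiff (- N) x)
          (trans (cong (λ s → s - N * col x zero - (- N) * (row x zero - N * x (zero , zero))) tot≡0)
                 (trans (regroup N (row x zero) (col x zero) (x (zero , zero)))
                        (trans (cong (λ w → N * w - (N + N) * N * x (zero , zero)) eq) (factor N q (x (zero , zero)))))))
        2N∣rowColInvariant
      where regroup : ∀ N a b e → 0ℤ - N * b - (- N) * (a - N * e) ≡ N * (a - b + N * e) - (N + N) * N * e
            regroup = solve-∀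
            factor : ∀ N q e → N * (q * (+ 2 * N)) - (N + N) * N * e ≡ (q - e) * (+ 2 * N * N)
            factor = solve-∀

    D∣sum-rowDiff : D ∣ sumFin (rowDiff (- N) x)
    D∣sum-rowDiff =
      ∣-map (λ q → - q)
        (λ q eq → trans (sum-rowDiff (- N) x)
          (trans (cong (λ s → s - N * row x zero - (- N) * (col x zero - N * x (zero , zero))) tot≡0)
                 (trans (regroup N (row x zero) (col x zero) (x (zero , zero)))
                        (trans (cong ((- N) *_) eq) (factor N q)))))
        2N∣rowColInvariant
      where regroup : ∀ N a b e → 0ℤ - N * a - (- N) * (b - N * e) ≡ (- N) * (a - b + N * e)
            regroup = solve-∀
            factor : ∀ N q → (- N) * (q * (+ 2 * N)) ≡ (- q) * (+ 2 * N * N)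
            factor = solve-∀

    D∣colDiff : ∀ j → D ∣ colDiff (- N) x j
    D∣colDiff = ∣-from-sum (colDiff (- N) x) (∣-respʳ (sym (colDiff-zero (- N) x)) ∣0)
      (λ q → ∣-respˡ 2n²≡ (d∣φ (inj₂ (inj₁ q)))) D∣sum-colDiff

    D∣rowDiff : ∀ i → D ∣ rowDiff (- N) x i
    D∣rowDiff = ∣-from-sum (rowDiff (- N) x) (∣-respʳ (sym (rowDiff-zero (- N) x)) ∣0)
      (λ p → ∣-respˡ 2n²≡ (d∣φ (inj₂ (inj₂ p)))) D∣sum-rowDiff

    2N∣mixedDiff : ∀ i j → 2N ∣ mixedDiff x i j
    2N∣mixedDiff = mixedDiff-∣ (- N) x (divides (- 1ℤ) (double N))
      (λ p q → ∣-respˡ 2n≡ (d∣φ (inj₁ (inj₁ (p , q)))))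
      (λ j → ∣-trans 2N∣D (D∣colDiff j)) (λ p → ∣-trans 2N∣D (D∣rowDiff (inner p)))
      where
        double : ∀ N → - N - N ≡ (- 1ℤ) * (+ 2 * N)
        double = solve-∀
        2N∣D : 2N ∣ D
        2N∣D = divides N (ℤP.*-comm 2N N)

    D∣centred : ∀ v → D ∣ centred x v
    D∣centred (i , j) =
      ∣-respʳ (sym (regroup N (x (i , j)) (x (i , zero)) (x (zero , j)) (x (zero , zero))
                            (row x i) (row x zero) (col x j) (col x zero) (tot x)))
        (∣m∣n⇒∣m+n (∣m∣n⇒∣m+n (D∣rowDiff i) (D∣colDiff j))
                   (∣-map (λ q → q) (λ q eq → trans (cong (N *_) eq) (reassoc q N)) (2N∣mixedDiff i j)))
      where
        regroup : ∀ N X Xi0 X0j X00 ri r0 cj c0 s →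
          N * X + 1ℤ * (ri + cj) + 0ℤ * s - (N * X00 + 1ℤ * (r0 + c0) + 0ℤ * s) ≡
          (ri - r0 - (- N) * (Xi0 - X00)) + (cj - c0 - (- N) * (X0j - X00)) + N * (X - Xi0 - X0j + X00)
        regroup = solve-∀
        reassoc : ∀ q N → N * (q * (+ 2 * N)) ≡ q * (+ 2 * N * N)
        reassoc = solve-∀

  module Preimage (z : I → ℤ) where

    U : Fin m₂ → Fin m₂ → ℤ
    U p q = z (inj₁ (inj₁ (p , q)))

    w : ℤ
    w = z (inj₁ (inj₂ tt))

    colTarget rowTarget : Fin m₂ → ℤ
    colTarget q = z (inj₂ (inj₁ q))
    rowTarget p = z (inj₂ (inj₂ p))

    g f : Fin m₂ → ℤ
    g p = rowTarget p + w - sumFin (U p)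
    f q = colTarget q - sumFin (λ p → U p q)

    -- The corner entry e is chosen to make the total vanish.
    e : ℤ
    e = - (w + sumFin f + sumFin g + sumFin (λ p → sumFin (U p)))

    open Template w 0ℤ e f g U public

    tot≡0 : tot template ≡ 0ℤ
    tot≡0 = trans tot-template (cancel w Σf Σg ΣU)
      where cancel : ∀ a sf sg ss → a + (0ℤ + (- (a + sf + sg + ss) + sf) + (sg + ss)) ≡ 0ℤ
            cancel = solve-∀

    φ-template : ∀ q → + d q ∣ φ q template - z q
    φ-template (inj₁ (inj₁ (p , q))) = divides 0ℤ (cancel (U p q) 2N)
      where cancel : ∀ u D → u - 0ℤ - 0ℤ + 0ℤ - u ≡ 0ℤ * D
            cancel = solve-∀
    φ-template (inj₁ (inj₂ _)) =
      divides 0ℤ (trans (cong₂ (λ a b → a - b + N * 0ℤ - w) row-zero col-zero) (cancel w N 2N))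
      where cancel : ∀ w N D → w - 0ℤ + N * 0ℤ - w ≡ 0ℤ * D
            cancel = solve-∀
    φ-template (inj₂ (inj₁ q)) =
      divides 0ℤ (trans (cong₂ (λ a b → a - b - (- N) * (0ℤ - 0ℤ) - colTarget q) (col-inner q) col-zero)
                        (cancel (colTarget q) (ΣUᶜ q) N D))
      where cancel : ∀ y s N D → y - s + s - 0ℤ - (- N) * (0ℤ - 0ℤ) - y ≡ 0ℤ * D
            cancel = solve-∀
    φ-template (inj₂ (inj₂ p)) =
      divides 0ℤ (trans (cong₂ (λ a b → a - b - (- N) * (0ℤ - 0ℤ) - rowTarget p) (row-inner p) row-zero)
                        (cancel (rowTarget p) w (ΣUʳ p) N D))
      where cancel : ∀ y w s N D → y + w - s + s - w - (- N) * (0ℤ - 0ℤ) - y ≡ 0ℤ * D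
            cancel = solve-∀

  D≡1+ : D ≡ + suc (ℕ.pred (2 ℕ.* n ℕ.* n))
  D≡1+ = sym (trans (ℤP.pos-* (2 ℕ.* n) n) (cong (_* N) (ℤP.pos-* 2 n)))

  criticalGroup : CriticalGroupIso (rookAdj n)
    (replicate ((n ∸ 2) ^ 2 ℕ.+ 1) (2 ℕ.* n) ++ replicate (2 ℕ.* (n ∸ 2)) (2 ℕ.* n ^ 2))
  criticalGroup = FromInvariants.isoDirectSum L (IsTorsion L) d enum φ φ-cong φ-+
    (λ q z → ∣-respʳ (sym (φ-cong q (apply-laplacian-rookAdj z))) (φ-rookOp q z))
    (λ {x} {y} tx ty d∣φ → ∈-image (x -ᵥ y) (tot-x-y tx ty) (Kernel.D∣centred (x -ᵥ y) (tot-x-y tx ty) d∣φ))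
    (λ z → Preimage.template z , tot≡0⇒torsion D≡1+ (Preimage.template z) (Preimage.tot≡0 z) , Preimage.φ-template z)
    where
      tot-x-y : ∀ {x y} → IsTorsion L x → IsTorsion L y → tot (x -ᵥ y) ≡ 0ℤ
      tot-x-y {x} {y} tx ty = trans (tot-- x y) (cong₂ _-_ (torsion⇒tot≡0 x tx) (torsion⇒tot≡0 y ty))

module CriticalComplement (k : ℕ) where

  open import Defs
  open FinSum
  open IntDivisibility
  open DirectSum
  open Differences k
  open import Data.Nat using (_∸_; _^_)
  import Data.Nat as ℕ
  import Data.Nat.Properties as ℕP
  open import Data.Integer using (ℤ; +_; _-_; _*_; _+_; 0ℤ; 1ℤ; -_)
  import Data.Integer.Properties as ℤP
  open import Data.Integer.Divisibility.Signed using (_∣_; divides; ∣-trans; ∣m∣n⇒∣m+n; ∣m∣n⇒∣m-n; ∣m⇒∣-m)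
  open import Data.Fin using (Fin; zero; suc)
  open import Data.Fin.Properties using (+↔⊎; *↔×)
  open import Data.List using (replicate; _++_)
  open import Data.Sum using (_⊎_; inj₁; inj₂; [_,_]′)
  open import Data.Sum.Function.Propositional using (_⊎-↔_)
  open import Data.Product using (_×_; _,_)
  open import Function using (const)
  open import Function.Properties.Inverse using (↔-refl; ↔-trans)
  open import Relation.Binary.PropositionalEquality using (_≡_; sym; trans; cong; cong₂)
  open import Data.Integer.Tactic.RingSolver using (solve-∀)
  import Data.Nat.Tactic.RingSolver as ℕ-Solver

  open RookOperator {n}
  open Image {n}

  m₁ m₂ : ℕ
  m₁ = suc (suc k)
  m₂ = suc k

  M₁ M₂ : ℤ
  M₁ = + m₁
  M₂ = + m₂

  L : Mat n
  L = laplacian (rookCompAdj n)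

  -- The inner mixed differences other than the one at (inner 0 , inner 0).
  I₁ : Set
  I₁ = Fin k ⊎ (Fin k × Fin m₂)

  I : Set
  I = I₁ ⊎ (Fin 2 ⊎ (Fin m₂ ⊎ Fin m₂))

  d : I → ℕ
  d = [ const (n ℕ.* m₂) , [ const (n ℕ.* m₁ ℕ.* m₂) , const (n ^ 2 ℕ.* m₁ ℕ.* m₂) ]′ ]′

  enum : Enumerates d
    (replicate ((n ∸ 2) ^ 2 ∸ 1) (n ℕ.* (n ∸ 2)) ++ replicate 2 (n ℕ.* (n ∸ 1) ℕ.* (n ∸ 2))
       ++ replicate (2 ℕ.* (n ∸ 2)) (n ^ 2 ℕ.* (n ∸ 1) ℕ.* (n ∸ 2)))
  enum = enumerates-++
    (enumerates-replicate ((n ∸ 2) ^ 2 ∸ 1) (n ℕ.* m₂)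
      (↔-trans (Fin-cast↔ (m₂²-1≡k+k*m₂ k)) (↔-trans +↔⊎ (↔-refl ⊎-↔ *↔×))))
    (enumerates-++ (enumerates-replicate 2 (n ℕ.* m₁ ℕ.* m₂) ↔-refl)
                   (enumerates-replicate (2 ℕ.* (n ∸ 2)) (n ^ 2 ℕ.* m₁ ℕ.* m₂)
                     (↔-trans (Fin-cast↔ (cong (m₂ ℕ.+_) (ℕP.+-identityʳ m₂))) +↔⊎)))
    where m₂²-1≡k+k*m₂ : ∀ k → k ℕ.* 1 ℕ.+ k ℕ.* suc (k ℕ.* 1) ≡ k ℕ.+ k ℕ.* suc k
          m₂²-1≡k+k*m₂ = ℕ-Solver.solve-∀

  nm₂≡ : + (n ℕ.* m₂) ≡ N * M₂
  nm₂≡ = ℤP.pos-* n m₂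

  nm₁m₂≡ : + (n ℕ.* m₁ ℕ.* m₂) ≡ N * M₁ * M₂
  nm₁m₂≡ = trans (ℤP.pos-* (n ℕ.* m₁) m₂) (cong (_* M₂) (ℤP.pos-* n m₁))

  n²m₁m₂≡ : + (n ^ 2 ℕ.* m₁ ℕ.* m₂) ≡ N * N * M₁ * M₂
  n²m₁m₂≡ = trans (ℤP.pos-* (n ^ 2 ℕ.* m₁) m₂)
                 (cong (_* M₂) (trans (ℤP.pos-* (n ^ 2) m₁)
                                      (cong (_* M₁) (trans (ℤP.pos-* n (n ℕ.* 1)) (cong (N *_) (cong +_ (ℕP.*-identityʳ n)))))))

  NM₁ : ℤ
  NM₁ = N * M₁

  colMixedInvariant rowColInvariant : Vec n → ℤ
  colMixedInvariant x = N * M₂ * col x zero + M₁ * mixedDiff x (inner zero) (inner zero)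
  rowColInvariant x = row x zero + M₁ * col x zero - N * M₁ * x (zero , zero)

  φ : I → Vec n → ℤ
  φ (inj₁ (inj₁ q))          x = mixedDiff x (inner zero) (inner (suc q))
  φ (inj₁ (inj₂ (p , q)))    x = mixedDiff x (inner (suc p)) (inner q)
  φ (inj₂ (inj₁ zero))       x = colMixedInvariant x
  φ (inj₂ (inj₁ (suc zero))) x = rowColInvariant x
  φ (inj₂ (inj₂ (inj₁ q)))   x = colDiff NM₁ x (inner q)
  φ (inj₂ (inj₂ (inj₂ p)))   x = rowDiff NM₁ x (inner p)

  φ-cong : ∀ q {x y : Vec n} → (∀ v → x v ≡ y v) → φ q x ≡ φ q y
  φ-cong (inj₁ (inj₁ q))          x≗y = mixedDiff-cong x≗y (inner zero) (inner (suc q))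
  φ-cong (inj₁ (inj₂ (p , q)))    x≗y = mixedDiff-cong x≗y (inner (suc p)) (inner q)
  φ-cong (inj₂ (inj₁ zero))       x≗y =
    cong₂ _+_ (cong (N * M₂ *_) (col-cong x≗y zero)) (cong (M₁ *_) (mixedDiff-cong x≗y (inner zero) (inner zero)))
  φ-cong (inj₂ (inj₁ (suc zero))) x≗y =
    cong₂ _-_ (cong₂ _+_ (row-cong x≗y zero) (cong (M₁ *_) (col-cong x≗y zero))) (cong (N * M₁ *_) (x≗y (zero , zero)))
  φ-cong (inj₂ (inj₂ (inj₁ q)))   x≗y = colDiff-cong x≗y NM₁ (inner q)
  φ-cong (inj₂ (inj₂ (inj₂ p)))   x≗y = rowDiff-cong x≗y NM₁ (inner p)

  φ-+ : ∀ q x y → φ q (x +ᵥ y) ≡ φ q x + φ q y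
  φ-+ (inj₁ (inj₁ q))          x y = mixedDiff-+ x y (inner zero) (inner (suc q))
  φ-+ (inj₁ (inj₂ (p , q)))    x y = mixedDiff-+ x y (inner (suc p)) (inner q)
  φ-+ (inj₂ (inj₁ zero))       x y =
    trans (cong₂ (λ a b → N * M₂ * a + M₁ * b) (col-+ x y zero) (mixedDiff-+ x y (inner zero) (inner zero)))
          (interchange (N * M₂) M₁ (col x zero) (col y zero) (mixedDiff x (inner zero) (inner zero)) (mixedDiff y (inner zero) (inner zero)))
    where interchange : ∀ A B a a′ b b′ → A * (a + a′) + B * (b + b′) ≡ A * a + B * b + (A * a′ + B * b′)
          interchange = solve-∀
  φ-+ (inj₂ (inj₁ (suc zero))) x y =
    trans (cong₂ (λ a b → a + M₁ * b - N * M₁ * (x (zero , zero) + y (zero , zero))) (row-+ x y zero) (col-+ x y zero))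
          (interchange M₁ (N * M₁) (row x zero) (row y zero) (col x zero) (col y zero) (x (zero , zero)) (y (zero , zero)))
    where interchange : ∀ A B a a′ b b′ e e′ → a + a′ + A * (b + b′) - B * (e + e′) ≡ a + A * b - B * e + (a′ + A * b′ - B * e′)
          interchange = solve-∀
  φ-+ (inj₂ (inj₂ (inj₁ q)))   x y = colDiff-+ NM₁ x y (inner q)
  φ-+ (inj₂ (inj₂ (inj₂ p)))   x y = rowDiff-+ NM₁ x y (inner p)

  α : ℤ
  α = N * N - N - N

  private
    mixed : ∀ M u → let N = 1ℤ + (1ℤ + M) in (N * N - N - N) * u ≡ u * (N * M)
    mixed = solve-∀
    difference : ∀ M a b c d → let N = 1ℤ + (1ℤ + M) in
      (N * N - N - N + 1ℤ * N - N * (1ℤ + M) * 1ℤ) * (a - b) - N * (1ℤ + M) * (N * N - N - N) * (c - d)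
      ≡ (- (c - d)) * (N * N * (1ℤ + M) * M)
    difference = solve-∀

  φ-rookOp : ∀ q z → + d q ∣ φ q (rookOp α 1ℤ (- 1ℤ) z)
  φ-rookOp (inj₁ (inj₁ q)) z =
    ∣-respʳ (sym (mixedDiff-rookOp α 1ℤ (- 1ℤ) z (inner zero) (inner (suc q))))
            (divides′ nm₂≡ (mixedDiff z (inner zero) (inner (suc q))) (mixed M₂ (mixedDiff z (inner zero) (inner (suc q)))))
  φ-rookOp (inj₁ (inj₂ (p , q))) z =
    ∣-respʳ (sym (mixedDiff-rookOp α 1ℤ (- 1ℤ) z (inner (suc p)) (inner q)))
            (divides′ nm₂≡ (mixedDiff z (inner (suc p)) (inner q)) (mixed M₂ (mixedDiff z (inner (suc p)) (inner q))))
  φ-rookOp (inj₂ (inj₁ zero)) z =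
    divides′ nm₁m₂≡ (N * col z zero - tot z + mixedDiff z (inner zero) (inner zero))
      (trans (cong₂ (λ a b → N * M₂ * a + M₁ * b) (col-rookOp α 1ℤ (- 1ℤ) z zero)
                    (mixedDiff-rookOp α 1ℤ (- 1ℤ) z (inner zero) (inner zero)))
             (collect M₂ (col z zero) (tot z) (mixedDiff z (inner zero) (inner zero))))
    where collect : ∀ M c s u → let N = 1ℤ + (1ℤ + M) in
            N * M * ((N * N - N - N + 1ℤ * N) * c + (1ℤ + (- 1ℤ) * N) * s) + (1ℤ + M) * ((N * N - N - N) * u)
            ≡ (N * c - s + u) * (N * (1ℤ + M) * M)
          collect = solve-∀
  φ-rookOp (inj₂ (inj₁ (suc zero))) z =
    divides′ nm₁m₂≡ (col z zero - N * z (zero , zero))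
      (trans (cong₂ (λ a b → a + M₁ * b - N * M₁ * rookOp α 1ℤ (- 1ℤ) z (zero , zero))
                    (row-rookOp α 1ℤ (- 1ℤ) z zero) (col-rookOp α 1ℤ (- 1ℤ) z zero))
             (collect M₂ (row z zero) (col z zero) (tot z) (z (zero , zero))))
    where collect : ∀ M a c s e → let N = 1ℤ + (1ℤ + M) in
            (N * N - N - N + 1ℤ * N) * a + (1ℤ + (- 1ℤ) * N) * s
              + (1ℤ + M) * ((N * N - N - N + 1ℤ * N) * c + (1ℤ + (- 1ℤ) * N) * s)
              - N * (1ℤ + M) * ((N * N - N - N) * e + 1ℤ * (a + c) + (- 1ℤ) * s)
            ≡ (c - N * e) * (N * (1ℤ + M) * M)
          collect = solve-∀
  φ-rookOp (inj₂ (inj₂ (inj₁ q))) z =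
    ∣-respʳ (sym (colDiff-rookOp NM₁ α 1ℤ (- 1ℤ) z (inner q)))
            (divides′ n²m₁m₂≡ (- (z (zero , inner q) - z (zero , zero)))
                      (difference M₂ (col z (inner q)) (col z zero) (z (zero , inner q)) (z (zero , zero))))
  φ-rookOp (inj₂ (inj₂ (inj₂ p))) z =
    ∣-respʳ (sym (rowDiff-rookOp NM₁ α 1ℤ (- 1ℤ) z (inner p)))
            (divides′ n²m₁m₂≡ (- (z (inner p , zero) - z (zero , zero)))
                      (difference M₂ (row z (inner p)) (row z zero) (z (inner p , zero)) (z (zero , zero))))

  D : ℤ
  D = N * N * M₁ * M₂

  onesEigenvalue≡0 : onesEigenvalue α 1ℤ (- 1ℤ) ≡ 0ℤ
  onesEigenvalue≡0 = cancel N
    where cancel : ∀ N → N * N - N - N + 1ℤ * N + 1ℤ * N + (- 1ℤ) * N * N ≡ 0ℤ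
          cancel = solve-∀

  inverse : ∀ x → tot x ≡ 0ℤ → ∀ i j → rookOp α 1ℤ (- 1ℤ) (rookOp NM₁ (- 1ℤ) 0ℤ x) (i , j) ≡ x (i , j) * D
  inverse x tot≡0 i j =
    trans (rookOp-∘ α 1ℤ (- 1ℤ) NM₁ (- 1ℤ) 0ℤ x i j)
          (trans (cong (λ s → α * NM₁ * x (i , j) + (α * (- 1ℤ) + 1ℤ * (NM₁ + (- 1ℤ) * N)) * (row x i + col x j)
                              + (α * 0ℤ + (1ℤ + 1ℤ) * ((- 1ℤ) + 0ℤ * N) + (- 1ℤ) * onesEigenvalue NM₁ (- 1ℤ) 0ℤ) * s)
                       tot≡0)
                 (collect M₂ (x (i , j)) (row x i + col x j)))
    where collect : ∀ M X RC → let N = 1ℤ + (1ℤ + M) in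
            (N * N - N - N) * (N * (1ℤ + M)) * X + ((N * N - N - N) * (- 1ℤ) + 1ℤ * (N * (1ℤ + M) + (- 1ℤ) * N)) * RC
              + ((N * N - N - N) * 0ℤ + (1ℤ + 1ℤ) * ((- 1ℤ) + 0ℤ * N)
                 + (- 1ℤ) * (N * (1ℤ + M) + (- 1ℤ) * N + (- 1ℤ) * N + 0ℤ * N * N)) * 0ℤ
            ≡ X * (N * N * (1ℤ + M) * M)
          collect = solve-∀

  open Laplacian L α 1ℤ (- 1ℤ) apply-laplacian-rookCompAdj (zero , zero) onesEigenvalue≡0 NM₁ (- 1ℤ) 0ℤ D inverse

  NM₂ NM₁M₂ : ℤ
  NM₂ = N * M₂
  NM₁M₂ = N * M₁ * M₂

  module Kernel (x : Vec n) (tot≡0 : tot x ≡ 0ℤ) (d∣φ : ∀ q → + d q ∣ φ q x) where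

    c₀ u₀₀ x₀₀ r₀ : ℤ
    c₀ = col x zero
    u₀₀ = mixedDiff x (inner zero) (inner zero)
    x₀₀ = x (zero , zero)
    r₀ = row x zero

    qX : ℤ
    qX = _∣_.quotient (∣-respˡ nm₁m₂≡ (d∣φ (inj₂ (inj₁ zero))))

    eqX : colMixedInvariant x ≡ qX * NM₁M₂
    eqX = _∣_.equality (∣-respˡ nm₁m₂≡ (d∣φ (inj₂ (inj₁ zero))))

    -- Since (n - 1)² - n (n - 2) = 1, divisibility of colMixedInvariant by n (n - 1)(n - 2)
    -- splits into (n - 1) ∣ c₀ and n (n - 2) ∣ u₀₀.
    t : ℤ
    t = M₁ * c₀ - qX * N * M₂ + u₀₀

    c₀≡ : c₀ ≡ t * M₁
    c₀≡ = trans (expand M₂ c₀ u₀₀)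
                (trans (cong (λ w → (1ℤ + M₂) * (1ℤ + M₂) * c₀ - w + (1ℤ + M₂) * u₀₀) eqX) (factor M₂ c₀ u₀₀ qX))
      where expand : ∀ M c u → c ≡ (1ℤ + M) * (1ℤ + M) * c - ((1ℤ + (1ℤ + M)) * M * c + (1ℤ + M) * u) + (1ℤ + M) * u
            expand = solve-∀
            factor : ∀ M c u q → (1ℤ + M) * (1ℤ + M) * c - q * ((1ℤ + (1ℤ + M)) * (1ℤ + M) * M) + (1ℤ + M) * u
                       ≡ ((1ℤ + M) * c - q * (1ℤ + (1ℤ + M)) * M + u) * (1ℤ + M)
            factor = solve-∀

    u₀₀≡ : u₀₀ ≡ (qX - t) * NM₂
    u₀₀≡ = ℤP.*-cancelˡ-≡ M₁ u₀₀ ((qX - t) * NM₂)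
      (trans (expand M₂ c₀ u₀₀) (trans (cong₂ (λ a b → a - N * M₂ * b) eqX c₀≡) (factor M₂ qX t)))
      where expand : ∀ M c u → (1ℤ + M) * u ≡ ((1ℤ + (1ℤ + M)) * M * c + (1ℤ + M) * u) - (1ℤ + (1ℤ + M)) * M * c
            expand = solve-∀
            factor : ∀ M q t → q * ((1ℤ + (1ℤ + M)) * (1ℤ + M) * M) - (1ℤ + (1ℤ + M)) * M * (t * (1ℤ + M))
                       ≡ (1ℤ + M) * ((q - t) * ((1ℤ + (1ℤ + M)) * M))
            factor = solve-∀

    qY : ℤ
    qY = _∣_.quotient (∣-respˡ nm₁m₂≡ (d∣φ (inj₂ (inj₁ (suc zero)))))

    eqY : rowColInvariant x ≡ qY * NM₁M₂
    eqY = _∣_.equality (∣-respˡ nm₁m₂≡ (d∣φ (inj₂ (inj₁ (suc zero)))))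

    D∣sum-rowDiff : D ∣ sumFin (rowDiff NM₁ x)
    D∣sum-rowDiff = divides (- qY)
      (trans (sum-rowDiff NM₁ x)
             (trans (cong (λ s → s - N * r₀ - NM₁ * (c₀ - N * x₀₀)) tot≡0)
                    (trans (regroup M₂ r₀ c₀ x₀₀) (trans (cong ((- (1ℤ + (1ℤ + M₂))) *_) eqY) (factor M₂ qY)))))
      where regroup : ∀ M a c e → let N = 1ℤ + (1ℤ + M) in
              0ℤ - N * a - N * (1ℤ + M) * (c - N * e) ≡ (- N) * (a + (1ℤ + M) * c - N * (1ℤ + M) * e)
            regroup = solve-∀
            factor : ∀ M q → let N = 1ℤ + (1ℤ + M) in (- N) * (q * (N * (1ℤ + M) * M)) ≡ (- q) * (N * N * (1ℤ + M) * M)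
            factor = solve-∀

    D∣sum-colDiff : D ∣ sumFin (colDiff NM₁ x)
    D∣sum-colDiff = divides (- ((1ℤ + M₂) * qY - t + x₀₀))
      (trans (sum-colDiff NM₁ x)
             (trans (cong (λ s → s - N * c₀ - NM₁ * (r₀ - N * x₀₀)) tot≡0)
                    (trans (regroup M₂ r₀ c₀ x₀₀)
                           (trans (cong₂ (λ a b → (- (1ℤ + (1ℤ + M₂))) * ((1ℤ + M₂) * a - (1ℤ + (1ℤ + M₂)) * M₂ * b
                                                    + (1ℤ + (1ℤ + M₂)) * (1ℤ + M₂) * M₂ * x₀₀)) eqY c₀≡)
                                  (factor M₂ qY t x₀₀)))))
      where regroup : ∀ M a c e → let N = 1ℤ + (1ℤ + M) in
              0ℤ - N * c - N * (1ℤ + M) * (a - N * e) ≡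
              (- N) * ((1ℤ + M) * (a + (1ℤ + M) * c - N * (1ℤ + M) * e) - N * M * c + N * (1ℤ + M) * M * e)
            regroup = solve-∀
            factor : ∀ M q t e → let N = 1ℤ + (1ℤ + M) in
              (- N) * ((1ℤ + M) * (q * (N * (1ℤ + M) * M)) - N * M * (t * (1ℤ + M)) + N * (1ℤ + M) * M * e)
              ≡ (- ((1ℤ + M) * q - t + e)) * (N * N * (1ℤ + M) * M)
            factor = solve-∀

    D∣colDiff : ∀ j → D ∣ colDiff NM₁ x j
    D∣colDiff = ∣-from-sum (colDiff NM₁ x) (∣-respʳ (sym (colDiff-zero NM₁ x)) ∣0)
      (λ q → ∣-respˡ n²m₁m₂≡ (d∣φ (inj₂ (inj₂ (inj₁ q))))) D∣sum-colDiff

    D∣rowDiff : ∀ i → D ∣ rowDiff NM₁ x i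
    D∣rowDiff = ∣-from-sum (rowDiff NM₁ x) (∣-respʳ (sym (rowDiff-zero NM₁ x)) ∣0)
      (λ p → ∣-respˡ n²m₁m₂≡ (d∣φ (inj₂ (inj₂ (inj₂ p))))) D∣sum-rowDiff

    NM₂∣mixedDiff-inner : ∀ p q → NM₂ ∣ mixedDiff x (inner p) (inner q)
    NM₂∣mixedDiff-inner zero    zero    = divides (qX - t) u₀₀≡
    NM₂∣mixedDiff-inner zero    (suc q) = ∣-respˡ nm₂≡ (d∣φ (inj₁ (inj₁ q)))
    NM₂∣mixedDiff-inner (suc p) q       = ∣-respˡ nm₂≡ (d∣φ (inj₁ (inj₂ (p , q))))

    NM₂∣mixedDiff : ∀ i j → NM₂ ∣ mixedDiff x i j
    NM₂∣mixedDiff = mixedDiff-∣ NM₁ x (divides 1ℤ (shift M₂)) NM₂∣mixedDiff-inner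
      (λ j → ∣-trans NM₂∣D (D∣colDiff j)) (λ p → ∣-trans NM₂∣D (D∣rowDiff (inner p)))
      where
        shift : ∀ M → (1ℤ + (1ℤ + M)) * (1ℤ + M) - (1ℤ + (1ℤ + M)) ≡ 1ℤ * ((1ℤ + (1ℤ + M)) * M)
        shift = solve-∀
        NM₂∣D : NM₂ ∣ D
        NM₂∣D = divides (N * M₁) (reassoc N M₁ M₂)
          where reassoc : ∀ N A B → N * N * A * B ≡ N * A * (N * B)
                reassoc = solve-∀

    D∣centred : ∀ v → D ∣ centred x v
    D∣centred (i , j) =
      ∣-respʳ (sym (regroup NM₁ (x (i , j)) (x (i , zero)) (x (zero , j)) x₀₀ (row x i) r₀ (col x j) c₀ (tot x)))
        (∣m∣n⇒∣m+n (∣m∣n⇒∣m-n (∣m⇒∣-m (D∣rowDiff i)) (D∣colDiff j))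
                   (∣-map (λ q → q) (λ q eq → trans (cong (NM₁ *_) eq) (reassoc q N M₁ M₂)) (NM₂∣mixedDiff i j)))
      where
        regroup : ∀ A X Xi0 X0j X00 ri r0 cj c0 s →
          A * X + (- 1ℤ) * (ri + cj) + 0ℤ * s - (A * X00 + (- 1ℤ) * (r0 + c0) + 0ℤ * s) ≡
          - (ri - r0 - A * (Xi0 - X00)) - (cj - c0 - A * (X0j - X00)) + A * (X - Xi0 - X0j + X00)
        regroup = solve-∀
        reassoc : ∀ q N A B → N * A * (q * (N * B)) ≡ q * (N * N * A * B)
        reassoc = solve-∀

  module Preimage (z : I → ℤ) where

    colMixedTarget rowColTarget : ℤ
    colMixedTarget = z (inj₂ (inj₁ zero))
    rowColTarget = z (inj₂ (inj₁ (suc zero)))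

    colTarget rowTarget : Fin m₂ → ℤ
    colTarget q = z (inj₂ (inj₂ (inj₁ q)))
    rowTarget p = z (inj₂ (inj₂ (inj₂ p)))

    U : Fin m₂ → Fin m₂ → ℤ
    U zero    zero    = M₁ * colMixedTarget
    U zero    (suc q) = z (inj₁ (inj₁ q))
    U (suc p) q       = z (inj₁ (inj₂ (p , q)))

    a b : ℤ
    b = - colMixedTarget
    a = rowColTarget + M₁ * colMixedTarget

    g f : Fin m₂ → ℤ
    g p = rowTarget p + a - sumFin (U p)
    f q = colTarget q + b - sumFin (λ p → U p q)

    e : ℤ
    e = - (a + b + sumFin f + sumFin g + sumFin (λ p → sumFin (U p)))

    open Template a b e f g U public

    tot≡0 : tot template ≡ 0ℤ
    tot≡0 = trans tot-template (cancel a b Σf Σg ΣU)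
      where cancel : ∀ a b sf sg ss → a + (b + (- (a + b + sf + sg + ss) + sf) + (sg + ss)) ≡ 0ℤ
            cancel = solve-∀

    φ-template : ∀ q → + d q ∣ φ q template - z q
    φ-template (inj₁ (inj₁ q)) = divides 0ℤ (cancel (U zero (suc q)) NM₂)
      where cancel : ∀ u D → u - 0ℤ - 0ℤ + 0ℤ - u ≡ 0ℤ * D
            cancel = solve-∀
    φ-template (inj₁ (inj₂ (p , q))) = divides 0ℤ (cancel (U (suc p) q) NM₂)
      where cancel : ∀ u D → u - 0ℤ - 0ℤ + 0ℤ - u ≡ 0ℤ * D
            cancel = solve-∀
    φ-template (inj₂ (inj₁ zero)) =
      divides 0ℤ (trans (cong (λ w → N * M₂ * w + M₁ * (M₁ * colMixedTarget - 0ℤ - 0ℤ + 0ℤ) - colMixedTarget) col-zero)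
                        (cancel M₂ colMixedTarget NM₁M₂))
      where cancel : ∀ M X D → (1ℤ + (1ℤ + M)) * M * (- X) + (1ℤ + M) * ((1ℤ + M) * X - 0ℤ - 0ℤ + 0ℤ) - X ≡ 0ℤ * D
            cancel = solve-∀
    φ-template (inj₂ (inj₁ (suc zero))) =
      divides 0ℤ (trans (cong₂ (λ u w → u + M₁ * w - N * M₁ * 0ℤ - rowColTarget) row-zero col-zero)
                        (cancel M₁ N rowColTarget colMixedTarget NM₁M₂))
      where cancel : ∀ A N Y X D → Y + A * X + A * (- X) - N * A * 0ℤ - Y ≡ 0ℤ * D
            cancel = solve-∀
    φ-template (inj₂ (inj₂ (inj₁ q))) =
      divides 0ℤ (trans (cong₂ (λ u w → u - w - NM₁ * (0ℤ - 0ℤ) - colTarget q) (col-inner q) col-zero)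
                        (cancel (colTarget q) b (ΣUᶜ q) NM₁ D))
      where cancel : ∀ y b s A D → y + b - s + s - b - A * (0ℤ - 0ℤ) - y ≡ 0ℤ * D
            cancel = solve-∀
    φ-template (inj₂ (inj₂ (inj₂ p))) =
      divides 0ℤ (trans (cong₂ (λ u w → u - w - NM₁ * (0ℤ - 0ℤ) - rowTarget p) (row-inner p) row-zero)
                        (cancel (rowTarget p) a (ΣUʳ p) NM₁ D))
      where cancel : ∀ y b s A D → y + b - s + s - b - A * (0ℤ - 0ℤ) - y ≡ 0ℤ * D
            cancel = solve-∀

  D≡1+ : D ≡ + suc (ℕ.pred (n ℕ.* n ℕ.* m₁ ℕ.* m₂))
  D≡1+ = sym (trans (ℤP.pos-* (n ℕ.* n ℕ.* m₁) m₂)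
                    (cong (_* M₂) (trans (ℤP.pos-* (n ℕ.* n) m₁) (cong (_* M₁) (ℤP.pos-* n n)))))

  criticalGroup : CriticalGroupIso (rookCompAdj n)
    (replicate ((n ∸ 2) ^ 2 ∸ 1) (n ℕ.* (n ∸ 2)) ++ replicate 2 (n ℕ.* (n ∸ 1) ℕ.* (n ∸ 2))
       ++ replicate (2 ℕ.* (n ∸ 2)) (n ^ 2 ℕ.* (n ∸ 1) ℕ.* (n ∸ 2)))
  criticalGroup = FromInvariants.isoDirectSum L (IsTorsion L) d enum φ φ-cong φ-+
    (λ q z → ∣-respʳ (sym (φ-cong q (apply-laplacian-rookCompAdj z))) (φ-rookOp q z))
    (λ {x} {y} tx ty d∣φ → ∈-image (x -ᵥ y) (tot-x-y tx ty) (Kernel.D∣centred (x -ᵥ y) (tot-x-y tx ty) d∣φ))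
    (λ z → Preimage.template z , tot≡0⇒torsion D≡1+ (Preimage.template z) (Preimage.tot≡0 z) , Preimage.φ-template z)
    where
      tot-x-y : ∀ {x y} → IsTorsion L x → IsTorsion L y → tot (x -ᵥ y) ≡ 0ℤ
      tot-x-y {x} {y} tx ty = trans (tot-- x y) (cong₂ _-_ (torsion⇒tot≡0 x tx) (torsion⇒tot≡0 y ty))

open import Defs
open import Data.Nat using (_≤_; _∸_; _*_; _^_; zero; s≤s)
open import Data.List using (replicate; _++_; [_])
open import Data.Product using (_×_; _,_)

theorem1 : ∀ (n : ℕ) → 3 ≤ n →
      CriticalGroupIso (rookAdj n)
        (replicate ((n ∸ 2) ^ 2 Data.Nat.+ 1) (2 * n)
          ++ replicate (2 * (n ∸ 2)) (2 * n ^ 2))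
    × SmithGroupIso (rookAdj n)
        (replicate ((n ∸ 2) ^ 2) 2
          ++ replicate (2 * n ∸ 3) (2 * (n ∸ 2))
          ++ [ 2 * (n ∸ 1) * (n ∸ 2) ])
    × CriticalGroupIso (rookCompAdj n)
        (replicate ((n ∸ 2) ^ 2 ∸ 1) (n * (n ∸ 2))
          ++ replicate 2 (n * (n ∸ 1) * (n ∸ 2))
          ++ replicate (2 * (n ∸ 2)) (n ^ 2 * (n ∸ 1) * (n ∸ 2)))
    × SmithGroupIso (rookCompAdj n)
        (replicate (2 * (n ∸ 1)) (n ∸ 1)
          ++ [ (n ∸ 1) ^ 2 ])
theorem1 (suc zero)       (s≤s ())
theorem1 (suc (suc zero)) (s≤s (s≤s ()))
theorem1 (suc (suc (suc k))) _ =
  CriticalRook.criticalGroup k , SmithRook.smithGroup k , CriticalComplement.criticalGroup k , SmithComplement.smithGroup k
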